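{- For any integers $m,n>0$ and $0\le d\le\lfloor\frac{n-1}{2}\rfloor$, \[ \#\mathrm{APS}_d(m,n)=\sum_{k=0}^{d}(m-1)^k\binom{n}{k}\binom{n-k-1}{d-k} \] (with the convention $0^0=1$).
   Context: Let $m,n$ be positive integers, $[n]=\{1,\dots,n\}$ and $\xi=e^{2\pi i/m}$. For $0\le a\le m-1$ and $x\in[n]$ write $\xi^a(x)$ for $\xi^a\cdot x$, $\xi^a[n]=\{\xi^a(1),\dots,\xi^a(n)\}$, $\mathbb{I}_n^m=\bigcup_{a=0}^{m-1}\xi^a[n]$, totally ordered by $\xi^a(x)\prec\xi^b(y)$ iff $a>b$, or $a=b$ and $x>y$. $\mathbb{Z}_m\wr S_n$ is the group of bijections $w$ of $\mathbb{I}_n^m$ with $w(\xi^i x)=\xi^i w(x)$ for all $x\in[n]$, all $i$; it is written in one-line notation $w(n)\cdots w(1)$. $\operatorname{Pin}(w)=\{w(i):2\le i\le n-1,\ w(i+1)\prec w(i)\succ w(i-1)\}$. A set $P\subseteq\mathbb{I}_n^m$ is admissible if $P=\operatorname{Pin}(w)$ for some $w\in\mathbb{Z}_m\wr S_n$; $\mathrm{APS}_d(m,n)$ is the collection of admissible sets of cardinality at most $d$. -}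

module Defs where

open import Data.Nat as ℕ using (ℕ; zero; suc; _+_; _*_; _∸_; _^_; _≤_; _<_; z≤n; s≤s)
open import Data.Nat.Combinatorics using (_C_)
open import Data.Fin as Fin using (Fin; toℕ; fromℕ<)
open import Data.Bool using (Bool; true; false)
open import Data.Vec using (Vec; lookup; []; _∷_)
open import Data.List using (List; map; upTo; length)
open import Data.Nat.ListAction using (sum)
open import Data.Product using (Σ; ∃; ∃-syntax; _×_; _,_; proj₁)
open import Data.Sum using (_⊎_)
open import Data.List.Membership.Propositional using (_∈_)
open import Data.List.Relation.Unary.Unique.Propositional using (Unique)
open import Function.Bundles using (_⇔_)
open import Function.Definitions using (Bijective)
open import Relation.Binary.PropositionalEquality using (_≡_)
open import Relation.Nullary using (yes; no)

rot : ∀ {k} → Fin k → Fin k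
rot {suc k} i with toℕ i ℕ.<? k
... | yes p = fromℕ< (s≤s p)
... | no _  = Fin.zero

rotⁱ : ∀ {k} → ℕ → Fin k → Fin k
rotⁱ zero    a = a
rotⁱ (suc i) a = rot (rotⁱ i a)

-- The point ξ^a(x+1) of 𝕀ₙᵐ is represented by (a , x) with a : Fin m, x : Fin n
-- (x is the 0-based index of the element x+1 ∈ [n]).
Pt : ℕ → ℕ → Set
Pt m n = Fin m × Fin n

ξ^_·_ : ∀ {m n} → ℕ → Pt m n → Pt m n
ξ^ i · (a , x) = (rotⁱ i a , x)

emb : ∀ {m n} → 0 < m → Fin n → Pt m n
emb 0<m x = (fromℕ< 0<m , x)

_≺_ : ∀ {m n} → Pt m n → Pt m n → Set
(a , x) ≺ (b , y) = (b Fin.< a) ⊎ ((a ≡ b) × (y Fin.< x))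

record Wreath (m n : ℕ) (0<m : 0 < m) : Set where
  field
    w        : Pt m n → Pt m n
    bijective : Bijective _≡_ _≡_ w
    equivariant : ∀ (x : Fin n) (i : ℕ) →
      w (ξ^ i · emb 0<m x) ≡ ξ^ i · w (emb 0<m x)

-- p ∈ Pin(w): p = w(j) for some 2 ≤ j ≤ n-1 with w(j+1) ≺ w(j) ≻ w(j-1).
-- In 0-based indices: i, j, k consecutive positions in Fin n.
_∈Pin_ : ∀ {m n} {0<m : 0 < m} → Pt m n → Wreath m n 0<m → Set
_∈Pin_ {m} {n} {0<m} p W =
  ∃[ i ] ∃[ j ] ∃[ k ]
    (toℕ j ≡ suc (toℕ i)) × (toℕ k ≡ suc (toℕ j)) ×
    (w (emb 0<m j) ≡ p) ×
    (w (emb 0<m k) ≺ w (emb 0<m j)) × (w (emb 0<m i) ≺ w (emb 0<m j))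
  where open Wreath W

-- Subsets of 𝕀ₙᵐ as characteristic vectors (indexed by exponent a, then x).
SubsetI : ℕ → ℕ → Set
SubsetI m n = Vec (Vec Bool n) m

_∈S_ : ∀ {m n} → Pt m n → SubsetI m n → Set
(a , x) ∈S S = lookup (lookup S a) x ≡ true

countTrue : ∀ {n} → Vec Bool n → ℕ
countTrue [] = 0
countTrue (true  ∷ v) = suc (countTrue v)
countTrue (false ∷ v) = countTrue v


∣_∣ : ∀ {m n} → SubsetI m n → ℕ
∣_∣ [] = 0
∣_∣ (r ∷ S) = countTrue r + ∣ S ∣

Admissible : ∀ m n → 0 < m → SubsetI m n → Set
Admissible m n 0<m P =
  Σ (Wreath m n 0<m) λ W → ∀ (p : Pt m n) → (p ∈S P) ⇔ (p ∈Pin W)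

InAPS : ∀ m n → 0 < m → ℕ → SubsetI m n → Set
InAPS m n 0<m d P = Admissible m n 0<m P × (∣ P ∣ ≤ d)

HasCardAPS : ∀ m n → 0 < m → ℕ → ℕ → Set
HasCardAPS m n 0<m d N =
  Σ (List (SubsetI m n)) λ L →
    Unique L × (∀ P → (P ∈ L) ⇔ InAPS m n 0<m d P) × (length L ≡ N)

-- ∑_{k=0}^{d} (m-1)^k C(n,k) C(n-k-1,d-k)   (Agda's 0 ^ 0 = 1)
formula : ℕ → ℕ → ℕ → ℕ
formula m n d = sum (map (λ k → ((m ∸ 1) ^ k) * (n C k) * ((n ∸ k ∸ 1) C (d ∸ k))) (upTo (suc d)))

module Submission where

-- An admissible set P = Pin(w) meets every class {ξᵃ(x)} at most once, because pinnacles are values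
-- of w at distinct positions and w permutes the classes.  So P is a word in the letters N (no
-- pinnacle in the class), H c (the pinnacle ξᶜ(x), c < m - 1) and L (the pinnacle ξᵐ⁻¹(x) in the
-- ≺-lowest layer), read from class n down to class 1.  Both neighbours of a lowest-layer pinnacle
-- are lowest-layer non-pinnacles of larger class; counting them shows that the word is balanced:
-- at each L, the letters N above outnumber the letters L up to it.  Conversely, a balanced word with
-- at most (n - 1)/2 pinnacles is realised by interleaving the lowest-layer non-pinnacles, in
-- ≺-increasing order, with the pinnacles.  Choosing the positions and colours of the letters H gives
-- (m - 1)ᵏ C(n,k), and by the reflection principle the balanced N/L-words with at most d - k letters L
-- number C(n - k - 1, d - k).

open import Defs
open import Data.Bool using (Bool; true; false; _∧_)
import Data.Bool as Bool
open import Data.Bool.Properties using (∧-identityʳ; ¬-not)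
open import Data.Empty using (⊥)
open import Data.Fin using (Fin; zero; suc; toℕ; fromℕ; inject₁; cast; opposite; _>_; _≟_)
open import Data.Fin.Properties
  using ( toℕ-fromℕ; toℕ-fromℕ<; toℕ-inject₁; toℕ-injective; toℕ<n; toℕ≤pred[n]; toℕ-cast; cast-is-id
        ; cast-involutive; fromℕ≢inject₁; inject₁-injective; opposite-prop; opposite-involutive; ≤fromℕ; any? )
import Data.Fin.Properties as Finₚ
open import Data.Fin.Relation.Unary.Top using (view; ‵fromℕ; ‵inject₁)
open import Data.List using (List; []; _∷_; [_]; map; _++_; length; drop; upTo; concatMap; allFin; cartesianProductWith)
import Data.List as List
open import Data.List.Properties
  using (length-++; length-map; length-tabulate; map-++; drop-map; upTo-∷ʳ; map-cong-local)
import Data.List.Properties as Listₚ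
open import Data.List.Membership.Propositional using (_∈_; _∉_; find; lose)
open import Data.List.Membership.Propositional.Properties
  using ( ∈-map⁺; ∈-map⁻; ∈-++⁺ˡ; ∈-++⁺ʳ; ∈-++⁻; ∈-allFin; ∈-upTo⁺; ∈-upTo⁻
        ; ∈-cartesianProductWith⁺; ∈-cartesianProductWith⁻; ∈-concatMap⁺; ∈-concatMap⁻ )
open import Data.List.Relation.Binary.Disjoint.Propositional using (Disjoint)
open import Data.List.Relation.Binary.Permutation.Propositional using (_↭_; ↭-sym; ↭-trans; ↭-reflexive; prep)
open import Data.List.Relation.Binary.Permutation.Propositional.Properties using (∈-resp-↭; shift)
open import Data.List.Relation.Unary.All using ([])
import Data.List.Relation.Unary.All as All
import Data.List.Relation.Unary.All.Properties as Allₚ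
import Data.List.Relation.Unary.AllPairs as AllPairs
import Data.List.Relation.Unary.AllPairs.Properties as AllPairsₚ
open import Data.List.Relation.Unary.Any using (here; there)
open import Data.List.Relation.Unary.Linked using (Linked; []; [-]; _∷_)
import Data.List.Relation.Unary.Linked as Linked
import Data.List.Relation.Unary.Linked.Properties as Linkedₚ
open import Data.List.Relation.Unary.Unique.Propositional using (Unique; []; _∷_)
open import Data.List.Relation.Unary.Unique.Propositional.Properties
  using (++⁺; allFin⁺; cartesianProductWith⁺; concat⁺; upTo⁺) renaming (map⁺ to Unique-map⁺)
open import Data.Nat using (ℕ; zero; suc; _+_; _*_; _∸_; _^_; _≤_; _<_; _<?_; _/_; z≤n; s≤s)
import Data.Nat as ℕ
open import Data.Nat.Combinatorics using (_C_; nCk+nC[k+1]≡[n+1]C[k+1])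
open import Data.Nat.Combinatorics.Specification using (k>n⇒nCk≡0)
open import Data.Nat.DivMod using (m/n*n≤m)
open import Data.Nat.ListAction using (sum)
open import Data.Nat.ListAction.Properties using (sum-++)
open import Data.Nat.Properties hiding (_≟_)
open import Algebra.Properties.CommutativeSemigroup +-commutativeSemigroup using (interchange; x∙yz≈y∙xz)
open import Data.Nat.Tactic.RingSolver using (solve-∀)
open import Data.Product using (∃; ∃₂; ∃-syntax; _×_; _,_; proj₁; proj₂)
import Data.Product
open import Data.Product.Relation.Binary.Lex.Strict using (×-transitive; ×-asymmetric)
open import Data.Sum using (_⊎_; inj₁; inj₂)
open import Data.Unit using (⊤; tt)
open import Data.Vec using (Vec; []; _∷_; lookup; tabulate; replicate; zipWith; _∷ʳ_)
open import Data.Vec.Properties using (∷-injective; lookup-zipWith; lookup∘tabulate; tabulate∘lookup; tabulate-cong)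
open import Function using (flip; id; _∘_; case_of_; _⇔_; mk⇔; Equivalence)
open import Function.Properties.Equivalence using (⇔-setoid)
open import Level using (0ℓ)
open import Relation.Binary.Definitions using (Transitive; Asymmetric)
open import Relation.Binary.PropositionalEquality
  using (_≡_; _≢_; refl; sym; trans; cong; cong₂; subst; subst₂; isEquivalence; resp₂; module ≡-Reasoning)
import Relation.Binary.Reasoning.Setoid as SetoidReasoning
open import Relation.Nullary using (Dec; yes; no; does; ¬_)
open import Relation.Nullary.Decidable using (dec-true; dec-false; does-⇔; _×-dec_; ¬?)
open import Relation.Nullary.Negation using (contradiction)
open import Relation.Unary using (Pred; Decidable)

module ⇔-Reasoning = SetoidReasoning (⇔-setoid 0ℓ)

-- Ballot numbers and the reflection principle

afterL : (ℕ → ℕ → ℕ) → ℕ → ℕ → ℕ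
afterL f (suc (suc b)) (suc j) = f (suc b) j
afterL f _             _       = 0

-- ballots N b j is the number of balanced N/L-words of length N with j letters L, starting at height b.
ballots : ℕ → ℕ → ℕ → ℕ
ballots zero    b zero    = 1
ballots zero    b (suc j) = 0
ballots (suc N) b j       = ballots N (suc b) j + afterL (ballots N) b j

reflected : ℕ → ℕ → ℕ → ℕ
reflected N j       zero    = N C j
reflected N zero    (suc b) = 0
reflected N (suc j) (suc b) = reflected N j b

reflected-< : ∀ N {j b} → j < b → reflected N j b ≡ 0
reflected-< N {zero}  {suc b} _         = refl
reflected-< N {suc j} {suc b} (s≤s j<b) = reflected-< N j<b

reflected-pascal : ∀ N j b → reflected (suc N) (suc j) b ≡ reflected N j b + reflected N (suc j) b
reflected-pascal N j       zero          = sym (nCk+nC[k+1]≡[n+1]C[k+1] N j)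
reflected-pascal N zero    (suc zero)    = refl
reflected-pascal N zero    (suc (suc b)) = refl
reflected-pascal N (suc j) (suc b)       = reflected-pascal N j b

afterL-zero : ∀ f b → afterL f b 0 ≡ 0
afterL-zero f zero          = refl
afterL-zero f (suc zero)    = refl
afterL-zero f (suc (suc b)) = refl

ballots-zero : ∀ N b → ballots N b 0 ≡ 1
ballots-zero zero    b = refl
ballots-zero (suc N) b rewrite afterL-zero (ballots N) b = cong (_+ 0) (ballots-zero N (suc b))

-- André's reflection principle: the words violating the ballot condition correspond to the
-- unconstrained words with fewer letters L.
ballots-reflection : ∀ N b j → 2 * j ≤ N + suc b → ballots N (suc b) j + reflected N j (suc b) ≡ N C j
ballots-reflection zero b zero _ = refl
ballots-reflection zero b (suc j) h = reflected-< 0 (begin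
  suc j               ≡⟨ +-identityʳ (suc j) ⟨
  suc j + 0           ≤⟨ m≤n+m _ j ⟩
  j + (suc j + 0)     ≤⟨ ≤-pred h ⟩
  b                   ∎)
  where open ≤-Reasoning
ballots-reflection (suc N) b zero _ =
  cong₂ _+_ (cong₂ _+_ (ballots-zero N (suc (suc b))) (afterL-zero (ballots N) (suc b))) refl
ballots-reflection (suc N) zero (suc j) h = begin
  ballots N 2 (suc j) + 0 + reflected (suc N) (suc j) 1  ≡⟨ cong₂ _+_ (+-identityʳ _) (reflected-pascal N j 1) ⟩
  ballots N 2 (suc j) + (reflected N j 1 + N C j)        ≡⟨ +-assoc (ballots N 2 (suc j)) _ _ ⟨
  ballots N 2 (suc j) + reflected N j 1 + N C j          ≡⟨ cong (_+ N C j) (ballots-reflection N 1 (suc j) h′) ⟩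
  N C suc j + N C j                                     ≡⟨ +-comm (N C suc j) _ ⟩
  N C j + N C suc j                                     ≡⟨ nCk+nC[k+1]≡[n+1]C[k+1] N j ⟩
  suc N C suc j                                         ∎
  where
  open ≡-Reasoning
  h′ : 2 * suc j ≤ N + 2
  h′ = ≤-trans h (≤-reflexive (sym (+-suc N 1)))
ballots-reflection (suc N) (suc b) (suc j) h = begin
  X + Y + reflected (suc N) (suc j) (suc (suc b))            ≡⟨ cong (X + Y +_) (reflected-pascal N j (suc (suc b))) ⟩
  X + Y + (reflected N j (suc (suc b)) + reflected N j (suc b)) ≡⟨ interchange X Y _ _ ⟩
  (X + reflected N (suc j) (suc (suc (suc b)))) + (Y + reflected N j (suc b))
    ≡⟨ cong₂ _+_ (ballots-reflection N (suc (suc b)) (suc j) h₁) (ballots-reflection N b j h₂) ⟩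
  N C suc j + N C j                                          ≡⟨ +-comm (N C suc j) _ ⟩
  N C j + N C suc j                                          ≡⟨ nCk+nC[k+1]≡[n+1]C[k+1] N j ⟩
  suc N C suc j                                              ∎
  where
  open ≡-Reasoning
  X = ballots N (suc (suc (suc b))) (suc j)
  Y = ballots N (suc b) j
  h₁ : 2 * suc j ≤ N + suc (suc (suc b))
  h₁ = ≤-trans h (≤-reflexive (sym (+-suc N (suc (suc b)))))
  h₂ : 2 * j ≤ N + suc b
  h₂ = ≤-pred (≤-pred (subst₂ _≤_ (*-suc 2 j) (cong suc (+-suc N (suc b))) h))

sum-upTo-suc : ∀ (f : ℕ → ℕ) e → sum (map f (upTo (suc e))) ≡ sum (map f (upTo e)) + f e
sum-upTo-suc f e = begin
  sum (map f (upTo (suc e)))          ≡⟨ cong (sum ∘ map f) (upTo-∷ʳ e) ⟨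
  sum (map f (upTo e List.∷ʳ e))           ≡⟨ cong sum (map-++ f (upTo e) (e ∷ [])) ⟩
  sum (map f (upTo e) ++ f e ∷ [])    ≡⟨ sum-++ (map f (upTo e)) (f e ∷ []) ⟩
  sum (map f (upTo e)) + (f e + 0)    ≡⟨ cong (sum (map f (upTo e)) +_) (+-identityʳ (f e)) ⟩
  sum (map f (upTo e)) + f e          ∎
  where open ≡-Reasoning

sum-ballots : ∀ N e → 2 * e ≤ suc N → sum (map (ballots (suc N) 0) (upTo (suc e))) ≡ N C e
sum-ballots N zero _ = cong (_+ 0) (ballots-zero (suc N) 0)
sum-ballots N (suc e) h = begin
  sum (map (ballots (suc N) 0) (upTo (suc (suc e))))            ≡⟨ sum-upTo-suc (ballots (suc N) 0) (suc e) ⟩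
  sum (map (ballots (suc N) 0) (upTo (suc e))) + (ballots N 1 (suc e) + 0)
    ≡⟨ cong₂ _+_ (sum-ballots N e (≤-trans (*-monoʳ-≤ 2 (n≤1+n e)) h)) (+-identityʳ _) ⟩
  N C e + ballots N 1 (suc e)                                   ≡⟨ +-comm (N C e) _ ⟩
  ballots N 1 (suc e) + reflected N (suc e) 1
    ≡⟨ ballots-reflection N 0 (suc e) (≤-trans h (≤-reflexive (+-comm 1 N))) ⟩
  N C suc e                                                    ∎
  where open ≡-Reasoning

C*ballots-unfold : ∀ n k b j → (n C suc k) * ballots (n ∸ k) b j ≡
                  (n C suc k) * (ballots (n ∸ suc k) (suc b) j + afterL (ballots (n ∸ suc k)) b j)
C*ballots-unfold n k b j with k <? n
... | yes k<n rewrite +-∸-assoc 1 k<n = refl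
... | no k≮n rewrite k>n⇒nCk≡0 (s≤s (≮⇒≥ k≮n)) = refl

∸≡suc[∸∸1] : ∀ {k n} → k < n → n ∸ k ≡ suc (n ∸ k ∸ 1)
∸≡suc[∸∸1] {k} {n} k<n with n ∸ k | m<n⇒0<n∸m k<n
... | suc x | _ = refl

2[d∸k]≤n∸k : ∀ {d k n} → k ≤ d → 2 * d < n → 2 * (d ∸ k) ≤ n ∸ k
2[d∸k]≤n∸k {d} {k} {n} k≤d 2d<n = begin
  2 * (d ∸ k)       ≡⟨ *-distribˡ-∸ 2 d k ⟩
  2 * d ∸ 2 * k     ≤⟨ ∸-monoʳ-≤ (2 * d) (m≤n*m k 2) ⟩
  2 * d ∸ k         ≤⟨ ∸-monoˡ-≤ k (<⇒≤ 2d<n) ⟩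
  n ∸ k             ∎
  where open ≤-Reasoning

d≤[n∸1]/2⇒2d<n : ∀ {n d} → d ≤ (n ∸ 1) / 2 → 0 < n → 2 * d < n
d≤[n∸1]/2⇒2d<n {suc n} {d} d≤ _ = s≤s (begin
  2 * d          ≡⟨ *-comm 2 d ⟩
  d * 2          ≤⟨ *-monoˡ-≤ 2 d≤ ⟩
  n / 2 * 2      ≤⟨ m/n*n≤m n 2 ⟩
  n              ∎)
  where open ≤-Reasoning

length-cartesianProductWith : ∀ {A B C : Set} (f : A → B → C) xs ys →
  length (cartesianProductWith f xs ys) ≡ length xs * length ys
length-cartesianProductWith f []       ys = refl
length-cartesianProductWith f (x ∷ xs) ys = begin
  length (map (f x) ys ++ cartesianProductWith f xs ys)  ≡⟨ length-++ (map (f x) ys) ⟩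
  length (map (f x) ys) + length (cartesianProductWith f xs ys)
    ≡⟨ cong₂ _+_ (length-map (f x) ys) (length-cartesianProductWith f xs ys) ⟩
  length ys + length xs * length ys                      ∎
  where open ≡-Reasoning

length-concatMap : ∀ {A B : Set} (f : A → List B) xs → length (concatMap f xs) ≡ sum (map (length ∘ f) xs)
length-concatMap f []       = refl
length-concatMap f (x ∷ xs) = trans (length-++ (f x)) (cong (length (f x) +_) (length-concatMap f xs))

sum-map-* : ∀ {A : Set} c (f : A → ℕ) xs → sum (map (λ x → c * f x) xs) ≡ c * sum (map f xs)
sum-map-* c f []       = sym (*-zeroʳ c)
sum-map-* c f (x ∷ xs) = trans (cong (c * f x +_) (sum-map-* c f xs)) (sym (*-distribˡ-+ c (f x) _))

Unique-concatMap : ∀ {A B : Set} (f : A → List B) {xs} → Unique xs → (∀ x → Unique (f x)) →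
                   (∀ {x y} → x ≢ y → Disjoint (f x) (f y)) → Unique (concatMap f xs)
Unique-concatMap f {xs} xs-unique f-unique disjoint =
  concat⁺ (Allₚ.map⁺ (All.tabulate λ {x} _ → f-unique x)) (AllPairsₚ.map⁺ (AllPairs.map disjoint xs-unique))

lookup-∷ʳ-fromℕ : ∀ {A : Set} {n} (xs : Vec A n) y → lookup (xs ∷ʳ y) (fromℕ n) ≡ y
lookup-∷ʳ-fromℕ []       y = refl
lookup-∷ʳ-fromℕ (x ∷ xs) y = lookup-∷ʳ-fromℕ xs y

lookup-∷ʳ-inject₁ : ∀ {A : Set} {n} (xs : Vec A n) y i → lookup (xs ∷ʳ y) (inject₁ i) ≡ lookup xs i
lookup-∷ʳ-inject₁ (x ∷ xs) y zero    = refl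
lookup-∷ʳ-inject₁ (x ∷ xs) y (suc i) = lookup-∷ʳ-inject₁ xs y i

boolToℕ : Bool → ℕ
boolToℕ true  = 1
boolToℕ false = 0

does⇒ : ∀ {A : Set} (a? : Dec A) → does a? ≡ true → A
does⇒ (yes a) _ = a

∈-++-onlyˡ : ∀ {A : Set} {x : A} xs {ys} → x ∉ ys → x ∈ xs ++ ys ⇔ x ∈ xs
∈-++-onlyˡ xs {ys} x∉ys = mk⇔ to ∈-++⁺ˡ
  where
  to : _ ∈ xs ++ ys → _ ∈ xs
  to x∈ with ∈-++⁻ xs x∈
  ... | inj₁ x∈xs = x∈xs
  ... | inj₂ x∈ys = contradiction x∈ys x∉ys

∈-++-onlyʳ : ∀ {A : Set} {x : A} xs {ys} → x ∉ xs → x ∈ xs ++ ys ⇔ x ∈ ys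
∈-++-onlyʳ xs {ys} x∉xs = mk⇔ to (∈-++⁺ʳ xs)
  where
  to : _ ∈ xs ++ ys → _ ∈ ys
  to x∈ with ∈-++⁻ xs x∈
  ... | inj₁ x∈xs = contradiction x∈xs x∉xs
  ... | inj₂ x∈ys = x∈ys

does-≟-unique : ∀ {k} (g : Fin k → Bool) → (∀ {a a′} → g a ≡ true → g a′ ≡ true → a ≡ a′) →
                ∀ {b} → g b ≡ true → ∀ a → does (b ≟ a) ≡ g a
does-≟-unique g unique {b} gb a with b ≟ a
... | yes refl = sym gb
... | no  b≢a  with g a in ga
...   | false = refl
...   | true  = contradiction (unique gb ga) b≢a

∀-opposite : ∀ {n} (Q : Fin n → Set) → (∀ i → Q (opposite i)) → ∀ x → Q x
∀-opposite Q q x = subst Q (opposite-involutive x) (q (opposite x))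

opposite-< : ∀ {n} {c c′ : Fin n} → toℕ c < toℕ c′ → toℕ (opposite c′) < toℕ (opposite c)
opposite-< {n} {c} {c′} c<c′ rewrite opposite-prop c | opposite-prop c′ = ∸-monoʳ-< (s≤s c<c′) (toℕ<n c′)

opposite-injective : ∀ {n} {c c′ : Fin n} → opposite c ≡ opposite c′ → c ≡ c′
opposite-injective {c = c} {c′} eq = trans (sym (opposite-involutive c)) (trans (cong opposite eq) (opposite-involutive c′))

≗⇒≡ : ∀ {A : Set} {n} {xs ys : Vec A n} → (∀ i → lookup xs i ≡ lookup ys i) → xs ≡ ys
≗⇒≡ {xs = xs} {ys} eq = trans (sym (tabulate∘lookup xs)) (trans (tabulate-cong eq) (tabulate∘lookup ys))

countTrue-∷ʳ : ∀ {k} (r : Vec Bool k) b → countTrue (r ∷ʳ b) ≡ countTrue r + boolToℕ b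
countTrue-∷ʳ []           true  = refl
countTrue-∷ʳ []           false = refl
countTrue-∷ʳ (true  ∷ r)  b     = cong suc (countTrue-∷ʳ r b)
countTrue-∷ʳ (false ∷ r)  b     = countTrue-∷ʳ r b

countTrue-∷ : ∀ {k} b (r : Vec Bool k) → countTrue (b ∷ r) ≡ boolToℕ b + countTrue r
countTrue-∷ true  r = refl
countTrue-∷ false r = refl

∣zipWith-∷ʳ∣ : ∀ {k n} (S : Vec (Vec Bool n) k) (c : Vec Bool k) →
               ∣ zipWith _∷ʳ_ S c ∣ ≡ countTrue c + ∣ S ∣
∣zipWith-∷ʳ∣ []      []      = refl
∣zipWith-∷ʳ∣ (r ∷ S) (b ∷ c) = begin
  countTrue (r ∷ʳ b) + ∣ zipWith _∷ʳ_ S c ∣  ≡⟨ cong₂ _+_ (countTrue-∷ʳ r b) (∣zipWith-∷ʳ∣ S c) ⟩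
  (x + y) + (z + ∣ S ∣)                     ≡⟨ cong (_+ (z + ∣ S ∣)) (+-comm x y) ⟩
  (y + x) + (z + ∣ S ∣)                     ≡⟨ interchange y x z ∣ S ∣ ⟩
  (y + z) + (x + ∣ S ∣)                     ≡⟨ cong (_+ (x + ∣ S ∣)) (countTrue-∷ b c) ⟨
  countTrue (b ∷ c) + (x + ∣ S ∣)           ∎
  where
  open ≡-Reasoning
  x = countTrue r
  y = boolToℕ b
  z = countTrue c

∣replicate[]∣ : ∀ k → ∣ replicate k ([] {A = Bool}) ∣ ≡ 0
∣replicate[]∣ zero    = refl
∣replicate[]∣ (suc k) = ∣replicate[]∣ k

countTrue-false : ∀ k → countTrue (tabulate {n = k} (λ _ → false)) ≡ 0
countTrue-false zero    = refl
countTrue-false (suc k) = countTrue-false k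

countTrue-does-≟ : ∀ {k} (b : Fin k) → countTrue (tabulate (λ a → does (b ≟ a))) ≡ 1
countTrue-does-≟ {suc k} zero    = cong suc (countTrue-false k)
countTrue-does-≟ {suc k} (suc b) = countTrue-does-≟ b

count : ∀ {n} {P : Pred (Fin n) 0ℓ} → Decidable P → ℕ
count {zero}  P? = 0
count {suc n} P? = boolToℕ (does (P? zero)) + count (P? ∘ suc)

count-none : ∀ {n} {P : Pred (Fin n) 0ℓ} (P? : Decidable P) → (∀ i → ¬ P i) → count P? ≡ 0
count-none {zero}  P? none = refl
count-none {suc n} P? none rewrite dec-false (P? zero) (none zero) = count-none (P? ∘ suc) (none ∘ suc)

count-cong : ∀ {n} {P Q : Pred (Fin n) 0ℓ} (P? : Decidable P) (Q? : Decidable Q) →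
             (∀ i → does (P? i) ≡ does (Q? i)) → count P? ≡ count Q?
count-cong {zero}  P? Q? eq = refl
count-cong {suc n} P? Q? eq = cong₂ _+_ (cong boolToℕ (eq zero)) (count-cong (P? ∘ suc) (Q? ∘ suc) (eq ∘ suc))

count-remove : ∀ {n} {P : Pred (Fin n) 0ℓ} (P? : Decidable P) {y} → P y →
               count P? ≡ suc (count (λ i → P? i ×-dec ¬? (i ≟ y)))
count-remove {suc n} P? {zero} Py rewrite dec-true (P? zero) Py =
  cong suc (count-cong (P? ∘ suc) _ (λ i → sym (∧-identityʳ (does (P? (suc i))))))
count-remove {suc n} P? {suc y} Py = begin
  b + count (P? ∘ suc)                           ≡⟨ cong (b +_) (count-remove (P? ∘ suc) Py) ⟩
  b + suc (count P′?)                            ≡⟨ +-suc b _ ⟩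
  suc (b + count P′?)                            ≡⟨ cong suc (cong₂ _+_ b∧true≡b (count-cong P″? P′? λ _ → refl)) ⟨
  suc (boolToℕ (does (P? zero) ∧ true) + count P″?) ∎
  where
  open ≡-Reasoning
  b = boolToℕ (does (P? zero))
  b∧true≡b = cong boolToℕ (∧-identityʳ (does (P? zero)))
  P′? = λ i → P? (suc i) ×-dec ¬? (i ≟ y)
  P″? = λ i → P? (suc i) ×-dec ¬? (suc i ≟ suc y)

count-injection : ∀ {a b} {P : Pred (Fin a) 0ℓ} {Q : Pred (Fin b) 0ℓ} (P? : Decidable P) (Q? : Decidable Q) →
  (f : ∀ {i} → P i → Fin b) → (∀ {i} (p : P i) → Q (f p)) →
  (∀ {i j} (p : P i) (q : P j) → f p ≡ f q → i ≡ j) → count P? ≤ count Q?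
count-injection {zero}  P? Q? f into inj = z≤n
count-injection {suc a} {P = P} {Q} P? Q? f into inj with P? zero
... | no  _  = count-injection (P? ∘ suc) Q? f into (λ p q eq → Finₚ.suc-injective (inj p q eq))
... | yes p₀ = begin
  suc (count (P? ∘ suc))  ≤⟨ s≤s (count-injection (P? ∘ suc) Q′? f into′ (λ p q → Finₚ.suc-injective ∘ inj p q)) ⟩
  suc (count Q′?)         ≡⟨ count-remove Q? (into p₀) ⟨
  count Q?                ∎
  where
  open ≤-Reasoning
  Q′? = λ i → Q? i ×-dec ¬? (i ≟ f p₀)
  into′ : ∀ {i} (p : P (suc i)) → Q (f p) × f p ≢ f p₀
  into′ p = into p , λ eq → case inj p p₀ eq of λ ()

least : ∀ {n} {P : Pred (Fin n) 0ℓ} (P? : Decidable P) → ∃ P →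
        ∃ λ j → P j × (∀ i → toℕ i < toℕ j → ¬ P i)
least {suc n} P? (j , Pj) with P? zero
... | yes P0 = zero , P0 , λ _ ()
... | no ¬P0 with j
...   | zero   = contradiction Pj ¬P0
...   | suc j′ with least (P? ∘ suc) (j′ , Pj)
...     | j₀ , Pj₀ , below = suc j₀ , Pj₀ , λ { zero _ → ¬P0 ; (suc i) (s≤s i<j₀) → below i i<j₀ }

-- Each element of P has neighbours on both sides in U: then the right neighbours inject P into U,
-- missing the left neighbour of the first element of P.
count-neighbours : ∀ {n} {P U : Pred (Fin n) 0ℓ} (P? : Decidable P) (U? : Decidable U) →
  (∀ {j} → P j → ∃ λ i → toℕ j ≡ suc (toℕ i) × U i) →
  (∀ {j} → P j → ∃ λ k → toℕ k ≡ suc (toℕ j) × U k) →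
  ∃ P → suc (count P?) ≤ count U?
count-neighbours {P = P} {U} P? U? left right nonempty with least P? nonempty
... | j₀ , Pj₀ , first with left Pj₀
...   | i₀ , j₀≡1+i₀ , Ui₀ = begin
  suc (count P?)                                ≤⟨ s≤s (count-injection P? U′? (proj₁ ∘ right) into injective) ⟩
  suc (count U′?)                               ≡⟨ count-remove U? Ui₀ ⟨
  count U?                                      ∎
  where
  open ≤-Reasoning
  U′? = λ i → U? i ×-dec ¬? (i ≟ i₀)
  into : ∀ {j} (p : P j) → U (proj₁ (right p)) × proj₁ (right p) ≢ i₀
  into {j} p with right p
  ... | k , k≡1+j , Uk = Uk , λ { refl → first j (j<j₀ k≡1+j) p }
    where
    j<j₀ : toℕ i₀ ≡ suc (toℕ j) → toℕ j < toℕ j₀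
    j<j₀ eq = ≤-trans (n≤1+n _) (≤-reflexive (sym (trans j₀≡1+i₀ (cong suc eq))))
  injective : ∀ {i j} (p : P i) (q : P j) → proj₁ (right p) ≡ proj₁ (right q) → i ≡ j
  injective p q eq with right p | right q
  ... | _ , k≡1+i , _ | _ , k′≡1+j , _ = toℕ-injective (suc-injective (trans (sym k≡1+i) (trans (cong toℕ eq) k′≡1+j)))

module _ {m : ℕ} where

  toℕ-rot : (a : Fin (suc m)) → toℕ a < m → toℕ (rot a) ≡ suc (toℕ a)
  toℕ-rot a a<m with toℕ a <? m
  ... | yes a<m′ = toℕ-fromℕ< (s≤s a<m′)
  ... | no  a≮m  = contradiction a<m a≮m

  rot-last : (a : Fin (suc m)) → toℕ a ≡ m → rot a ≡ Fin.zero
  rot-last a a≡m with toℕ a <? m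
  ... | yes a<m = contradiction a≡m (<⇒≢ a<m)
  ... | no  _   = refl

  rotⁱ-+ : ∀ p q (a : Fin (suc m)) → rotⁱ (p + q) a ≡ rotⁱ p (rotⁱ q a)
  rotⁱ-+ zero    q a = refl
  rotⁱ-+ (suc p) q a = cong rot (rotⁱ-+ p q a)

  rotⁱ-comm : ∀ p q (a : Fin (suc m)) → rotⁱ p (rotⁱ q a) ≡ rotⁱ q (rotⁱ p a)
  rotⁱ-comm p q a = begin
    rotⁱ p (rotⁱ q a)  ≡⟨ rotⁱ-+ p q a ⟨
    rotⁱ (p + q) a     ≡⟨ cong (λ i → rotⁱ i a) (+-comm p q) ⟩
    rotⁱ (q + p) a     ≡⟨ rotⁱ-+ q p a ⟩
    rotⁱ q (rotⁱ p a)  ∎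
    where open ≡-Reasoning

  toℕ-rotⁱ : ∀ k (a : Fin (suc m)) → toℕ a + k ≤ m → toℕ (rotⁱ k a) ≡ toℕ a + k
  toℕ-rotⁱ zero    a _ = sym (+-identityʳ (toℕ a))
  toℕ-rotⁱ (suc k) a h = begin
    toℕ (rot (rotⁱ k a))  ≡⟨ toℕ-rot (rotⁱ k a) (subst (_< m) (sym ih) (≤-trans (≤-reflexive (sym (+-suc (toℕ a) k))) h)) ⟩
    suc (toℕ (rotⁱ k a))  ≡⟨ cong suc ih ⟩
    suc (toℕ a + k)       ≡⟨ +-suc (toℕ a) k ⟨
    toℕ a + suc k         ∎
    where
    open ≡-Reasoning
    ih = toℕ-rotⁱ k a (≤-trans (+-monoʳ-≤ (toℕ a) (n≤1+n k)) h)

  rotⁱ-zero : (a : Fin (suc m)) → rotⁱ (toℕ a) Fin.zero ≡ a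
  rotⁱ-zero a = toℕ-injective (toℕ-rotⁱ (toℕ a) Fin.zero (toℕ≤pred[n] a))

  rotⁱ-∸ : (a : Fin (suc m)) → rotⁱ (suc m ∸ toℕ a) a ≡ Fin.zero
  rotⁱ-∸ a = begin
    rotⁱ (suc m ∸ toℕ a) a        ≡⟨ cong (λ i → rotⁱ i a) (+-∸-assoc 1 (toℕ≤pred[n] a)) ⟩
    rot (rotⁱ (m ∸ toℕ a) a)      ≡⟨ rot-last _ (trans (toℕ-rotⁱ (m ∸ toℕ a) a (≤-reflexive a+[m∸a]≡m)) a+[m∸a]≡m) ⟩
    Fin.zero                      ∎
    where
    open ≡-Reasoning
    a+[m∸a]≡m : toℕ a + (m ∸ toℕ a) ≡ m
    a+[m∸a]≡m = m+[n∸m]≡n (toℕ≤pred[n] a)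

  rotⁱ-period : (a : Fin (suc m)) → rotⁱ (suc m) a ≡ a
  rotⁱ-period a = begin
    rotⁱ (suc m) a                           ≡⟨ cong (λ i → rotⁱ i a) (m+[n∸m]≡n (m≤n⇒m≤1+n (toℕ≤pred[n] a))) ⟨
    rotⁱ (toℕ a + (suc m ∸ toℕ a)) a         ≡⟨ rotⁱ-+ (toℕ a) (suc m ∸ toℕ a) a ⟩
    rotⁱ (toℕ a) (rotⁱ (suc m ∸ toℕ a) a)    ≡⟨ cong (rotⁱ (toℕ a)) (rotⁱ-∸ a) ⟩
    rotⁱ (toℕ a) Fin.zero                    ≡⟨ rotⁱ-zero a ⟩
    a                                        ∎
    where open ≡-Reasoning

  rot-injective : ∀ {a b : Fin (suc m)} → rot a ≡ rot b → a ≡ b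
  rot-injective {a} {b} eq = begin
    a                ≡⟨ rotⁱ-period a ⟨
    rotⁱ (suc m) a   ≡⟨ rotⁱ-comm 1 m a ⟩
    rotⁱ m (rot a)   ≡⟨ cong (rotⁱ m) eq ⟩
    rotⁱ m (rot b)   ≡⟨ rotⁱ-comm 1 m b ⟨
    rotⁱ (suc m) b   ≡⟨ rotⁱ-period b ⟩
    b                ∎
    where open ≡-Reasoning

  rotⁱ-injective : ∀ k {a b : Fin (suc m)} → rotⁱ k a ≡ rotⁱ k b → a ≡ b
  rotⁱ-injective zero    eq = eq
  rotⁱ-injective (suc k) eq = rotⁱ-injective k (rot-injective eq)

  rotⁱ-toℕ-comm : (a c : Fin (suc m)) → rotⁱ (toℕ a) c ≡ rotⁱ (toℕ c) a
  rotⁱ-toℕ-comm a c = begin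
    rotⁱ (toℕ a) c                        ≡⟨ cong (rotⁱ (toℕ a)) (rotⁱ-zero c) ⟨
    rotⁱ (toℕ a) (rotⁱ (toℕ c) Fin.zero)  ≡⟨ rotⁱ-comm (toℕ a) (toℕ c) Fin.zero ⟩
    rotⁱ (toℕ c) (rotⁱ (toℕ a) Fin.zero)  ≡⟨ cong (rotⁱ (toℕ c)) (rotⁱ-zero a) ⟩
    rotⁱ (toℕ c) a                        ∎
    where open ≡-Reasoning

  rotⁱ-toℕ-rotⁱ : ∀ i (c : Fin (suc m)) → rotⁱ (toℕ (rotⁱ i Fin.zero)) c ≡ rotⁱ i c
  rotⁱ-toℕ-rotⁱ i c = begin
    rotⁱ (toℕ (rotⁱ i Fin.zero)) c   ≡⟨ rotⁱ-toℕ-comm (rotⁱ i Fin.zero) c ⟩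
    rotⁱ (toℕ c) (rotⁱ i Fin.zero)   ≡⟨ rotⁱ-comm (toℕ c) i Fin.zero ⟩
    rotⁱ i (rotⁱ (toℕ c) Fin.zero)   ≡⟨ cong (rotⁱ i) (rotⁱ-zero c) ⟩
    rotⁱ i c                         ∎
    where open ≡-Reasoning

  rotⁱ-reach : (a b : Fin (suc m)) → rotⁱ (toℕ b + (suc m ∸ toℕ a)) a ≡ b
  rotⁱ-reach a b = begin
    rotⁱ (toℕ b + (suc m ∸ toℕ a)) a        ≡⟨ rotⁱ-+ (toℕ b) _ a ⟩
    rotⁱ (toℕ b) (rotⁱ (suc m ∸ toℕ a) a)   ≡⟨ cong (rotⁱ (toℕ b)) (rotⁱ-∸ a) ⟩
    rotⁱ (toℕ b) Fin.zero                   ≡⟨ rotⁱ-zero b ⟩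
    b                                       ∎
    where open ≡-Reasoning

  rotⁱ-toℕ-inverse : (b c : Fin (suc m)) → rotⁱ (toℕ (rotⁱ (suc m ∸ toℕ c) b)) c ≡ b
  rotⁱ-toℕ-inverse b c = begin
    rotⁱ (toℕ (rotⁱ (suc m ∸ toℕ c) b)) c   ≡⟨ rotⁱ-toℕ-comm (rotⁱ (suc m ∸ toℕ c) b) c ⟩
    rotⁱ (toℕ c) (rotⁱ (suc m ∸ toℕ c) b)   ≡⟨ rotⁱ-+ (toℕ c) (suc m ∸ toℕ c) b ⟨
    rotⁱ (toℕ c + (suc m ∸ toℕ c)) b        ≡⟨ cong (λ i → rotⁱ i b) (m+[n∸m]≡n (m≤n⇒m≤1+n (toℕ≤pred[n] c))) ⟩
    rotⁱ (suc m) b                          ≡⟨ rotⁱ-period b ⟩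
    b                                       ∎
    where open ≡-Reasoning

-- Peaks of sequences

module Peaks {A : Set} (_≺_ : A → A → Set) (≺-trans : Transitive _≺_) (≺-asym : Asymmetric _≺_) where

  PeakAt : ∀ {n} → (Fin n → A) → A → Set
  PeakAt f p = ∃[ i ] ∃[ j ] ∃[ k ]
    (toℕ j ≡ suc (toℕ i)) × (toℕ k ≡ suc (toℕ j)) × (f j ≡ p) × (f k ≺ f j) × (f i ≺ f j)

  data Peak : List A → A → Set where
    peak  : ∀ {a b c l} → a ≺ b → c ≺ b → Peak (a ∷ b ∷ c ∷ l) b
    later : ∀ {x l p} → Peak l p → Peak (x ∷ l) p

  PeakAt⇒Peak : ∀ {n} (f : Fin n → A) {p} → PeakAt f p → Peak (List.tabulate f) p
  PeakAt⇒Peak f (Fin.zero , Fin.suc Fin.zero , Fin.suc (Fin.suc Fin.zero) , _ , _ , refl , k≺j , i≺j) = peak i≺j k≺j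
  PeakAt⇒Peak f (Fin.suc i , Fin.suc j , Fin.suc k , j≡1+i , k≡1+j , refl , k≺j , i≺j) =
    later (PeakAt⇒Peak (f ∘ Fin.suc) (i , j , k , suc-injective j≡1+i , suc-injective k≡1+j , refl , k≺j , i≺j))
  PeakAt⇒Peak f (Fin.zero , Fin.suc Fin.zero , Fin.suc (Fin.suc (Fin.suc _)) , _ , () , _)
  PeakAt⇒Peak f (Fin.zero , Fin.suc Fin.zero , Fin.suc Fin.zero , _ , () , _)
  PeakAt⇒Peak f (Fin.zero , Fin.suc Fin.zero , Fin.zero , _ , () , _)
  PeakAt⇒Peak f (Fin.zero , Fin.suc (Fin.suc _) , _ , () , _)
  PeakAt⇒Peak f (_ , Fin.zero , _ , () , _)
  PeakAt⇒Peak f (Fin.suc _ , Fin.suc _ , Fin.zero , _ , () , _)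

  Peak⇒PeakAt : ∀ {n} (f : Fin n → A) {p} → Peak (List.tabulate f) p → PeakAt f p
  Peak⇒PeakAt {suc (suc (suc n))} f (peak a≺b c≺b) =
    Fin.zero , Fin.suc Fin.zero , Fin.suc (Fin.suc Fin.zero) , refl , refl , refl , c≺b , a≺b
  Peak⇒PeakAt {suc n} f (later pk) with Peak⇒PeakAt (f ∘ Fin.suc) pk
  ... | i , j , k , j≡1+i , k≡1+j , fj≡p , k≺j , i≺j =
    Fin.suc i , Fin.suc j , Fin.suc k , cong suc j≡1+i , cong suc k≡1+j , fj≡p , k≺j , i≺j

  tabulate-lookup-cast : ∀ (s : List A) {n} (e : n ≡ length s) → List.tabulate (List.lookup s ∘ cast e) ≡ s
  tabulate-lookup-cast s refl =
    trans (Listₚ.tabulate-cong (cong (List.lookup s) ∘ cast-is-id refl)) (Listₚ.tabulate-lookup s)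

  PeakAt-lookup⇔Peak : ∀ (s : List A) {n} (e : n ≡ length s) {p} → PeakAt (List.lookup s ∘ cast e) p ⇔ Peak s p
  PeakAt-lookup⇔Peak s e {p} = mk⇔
    (λ pk → subst′ (tabulate-lookup-cast s e) (PeakAt⇒Peak (List.lookup s ∘ cast e) pk))
    (λ pk → Peak⇒PeakAt (List.lookup s ∘ cast e) (subst′ (sym (tabulate-lookup-cast s e)) pk))
    where
    subst′ : ∀ {l l′} → l ≡ l′ → Peak l p → Peak l′ p
    subst′ refl pk = pk

  Linked⇒¬Peak : ∀ {l q} → Linked _≺_ l → Peak l q → ⊥
  Linked⇒¬Peak (_ ∷ b≺c ∷ _) (peak _ c≺b) = ≺-asym b≺c c≺b
  Linked⇒¬Peak (_ ∷ l)       (later pk)   = Linked⇒¬Peak l pk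

  Below : List A → List A → Set
  Below us       []       = ⊤
  Below []       (_ ∷ _)  = ⊥
  Below (u ∷ us) (p ∷ ps) = u ≺ p × Below us ps

  Below-++ : ∀ us ls hs → Below us ls → length ls + length hs ≤ length us →
             (∀ {u h} → u ∈ us → h ∈ hs → u ≺ h) → Below us (ls ++ hs)
  Below-++ us       []       []       _            _         _   = tt
  Below-++ (u ∷ us) []       (h ∷ hs) _            (s≤s len) u≺h =
    u≺h (here refl) (here refl) , Below-++ us [] hs tt len (λ u∈ h∈ → u≺h (there u∈) (there h∈))
  Below-++ (u ∷ us) (l ∷ ls) hs       (u≺l , below) (s≤s len) u≺h =
    u≺l , Below-++ us ls hs below len (u≺h ∘ there)

  mutual
    interleave : List A → List A → List A
    interleave []       ps = ps
    interleave (u ∷ us) ps = u ∷ interleave′ us ps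

    interleave′ : List A → List A → List A
    interleave′ us []       = us
    interleave′ us (p ∷ ps) = p ∷ interleave us ps

  mutual
    length-interleave : ∀ us ps → length (interleave us ps) ≡ length us + length ps
    length-interleave []       ps = refl
    length-interleave (u ∷ us) ps = cong suc (length-interleave′ us ps)

    length-interleave′ : ∀ us ps → length (interleave′ us ps) ≡ length us + length ps
    length-interleave′ us []       = sym (+-identityʳ (length us))
    length-interleave′ us (p ∷ ps) = trans (cong suc (length-interleave us ps)) (sym (+-suc (length us) (length ps)))

  Peak-∷∷ : ∀ {a b l q} → Peak (a ∷ b ∷ l) q → (q ≡ b × a ≺ b) ⊎ Peak (b ∷ l) q
  Peak-∷∷ (peak a≺b _) = inj₁ (refl , a≺b)
  Peak-∷∷ (later pk)   = inj₂ pk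

  -- In u₀ p₀ u₁ p₁ … with u₀ ≺ u₁ ≺ ⋯ and uᵢ₊₁ ≺ pᵢ, each pᵢ lies above both neighbours uᵢ ≺ uᵢ₊₁,
  -- while each uᵢ₊₁ lies below its neighbour pᵢ.
  Peak-interleave⇔ : ∀ us ps {q} → Linked _≺_ us → Below (drop 1 us) ps → Peak (interleave us ps) q ⇔ q ∈ ps
  Peak-interleave⇔ us ps asc below = mk⇔ (to us ps asc below) (from us ps asc below)
    where
    to : ∀ us ps {q} → Linked _≺_ us → Below (drop 1 us) ps → Peak (interleave us ps) q → q ∈ ps
    to []            []       _         _           ()
    to (u ∷ us)      []       asc       _           pk         = contradiction pk (Linked⇒¬Peak asc)
    to (u ∷ u′ ∷ us) (p ∷ ps) _         _           (peak _ _) = here refl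
    to (u ∷ u′ ∷ us) (p ∷ ps) (_ ∷ asc) (u′≺p , below) (later pk) with Peak-∷∷ pk
    ... | inj₁ (refl , p≺u′) = contradiction p≺u′ (≺-asym u′≺p)
    ... | inj₂ pk′           = there (to (u′ ∷ us) ps asc below pk′)

    from : ∀ us ps {q} → Linked _≺_ us → Below (drop 1 us) ps → q ∈ ps → Peak (interleave us ps) q
    from (u ∷ u′ ∷ us) (p ∷ ps) (u≺u′ ∷ _) (u′≺p , _)  (here refl) = peak (≺-trans u≺u′ u′≺p) u′≺p
    from (u ∷ u′ ∷ us) (p ∷ ps) (_ ∷ asc)  (_ , below) (there q∈)  = later (later (from (u′ ∷ us) ps asc below q∈))

-- ≺ is the lexicographic product of the reversed orders on exponents and on [n].
module _ {m n : ℕ} where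

  ≺-trans : Transitive (_≺_ {m} {n})
  ≺-trans = ×-transitive {_<₁_ = _>_} {_<₂_ = _>_} isEquivalence (resp₂ _>_)
              (flip Finₚ.<-trans) (flip Finₚ.<-trans)

  ≺-asym : Asymmetric (_≺_ {m} {n})
  ≺-asym = ×-asymmetric {_<₁_ = _>_} {_<₂_ = _>_} sym (resp₂ _>_) Finₚ.<-asym Finₚ.<-asym

  open Peaks (_≺_ {m} {n}) ≺-trans ≺-asym public

injectPt : ∀ {m n} → Pt m n → Pt m (suc n)
injectPt (a , x) = a , inject₁ x

injectPt-mono : ∀ {m n} {p q : Pt m n} → p ≺ q → injectPt p ≺ injectPt q
injectPt-mono                    (inj₁ b<a)         = inj₁ b<a
injectPt-mono {p = _ , x} {_ , y} (inj₂ (a≡b , y<x)) =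
  inj₂ (a≡b , subst₂ _<_ (sym (toℕ-inject₁ y)) (sym (toℕ-inject₁ x)) y<x)

Below-injectPt : ∀ {m n} (us ps : List (Pt m n)) → Below us ps → Below (map injectPt us) (map injectPt ps)
Below-injectPt us       []       _             = tt
Below-injectPt (u ∷ us) (p ∷ ps) (u≺p , below) = injectPt-mono u≺p , Below-injectPt us ps below

Below-∷ : ∀ {m n} c (u : Pt m n) us ps → Below us (drop (suc c) ps) → (∀ {p} → p ∈ ps → u ≺ p) →
          Below (u ∷ us) (drop c ps)
Below-∷ zero    u us []             _     _   = tt
Below-∷ (suc c) u us []             _     _   = tt
Below-∷ zero    u us (p ∷ ps)       below u≺ = u≺ (here refl) , below
Below-∷ (suc c) u us (p ∷ ps)       below u≺ = Below-∷ c u us ps below (u≺ ∘ there)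

Linked-injectPt : ∀ {m n} {l : List (Pt m n)} → Linked _≺_ l → Linked _≺_ (map injectPt l)
Linked-injectPt = Linkedₚ.map⁺ ∘ Linked.map injectPt-mono

Below-injectPt-drop : ∀ {m n} a c (us ps : List (Pt m n)) → Below (drop a us) (drop c ps) →
                      Below (drop a (map injectPt us)) (drop c (map injectPt ps))
Below-injectPt-drop a c us ps below rewrite drop-map {f = injectPt} a us | drop-map {f = injectPt} c ps =
  Below-injectPt (drop a us) (drop c ps) below

module _ {m n : ℕ} where

  classCount : Fin n → List (Pt m n) → ℕ
  classCount y []      = 0
  classCount y (p ∷ l) = boolToℕ (does (proj₂ p ≟ y)) + classCount y l

  classCount-++ : ∀ y (l l′ : List (Pt m n)) → classCount y (l ++ l′) ≡ classCount y l + classCount y l′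
  classCount-++ y []      l′ = refl
  classCount-++ y (p ∷ l) l′ = trans (cong (b +_) (classCount-++ y l l′)) (sym (+-assoc b (classCount y l) (classCount y l′)))
    where b = boolToℕ (does (proj₂ p ≟ y))

  mutual
    classCount-interleave : ∀ y (us ps : List (Pt m n)) → classCount y (interleave us ps) ≡ classCount y us + classCount y ps
    classCount-interleave y []       ps = refl
    classCount-interleave y (u ∷ us) ps =
      trans (cong (b +_) (classCount-interleave′ y us ps)) (sym (+-assoc b (classCount y us) (classCount y ps)))
      where b = boolToℕ (does (proj₂ u ≟ y))

    classCount-interleave′ : ∀ y (us ps : List (Pt m n)) → classCount y (interleave′ us ps) ≡ classCount y us + classCount y ps
    classCount-interleave′ y us []       = sym (+-identityʳ (classCount y us))
    classCount-interleave′ y us (p ∷ ps) =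
      trans (cong (b +_) (classCount-interleave y us ps)) (x∙yz≈y∙xz b (classCount y us) (classCount y ps))
      where b = boolToℕ (does (proj₂ p ≟ y))

  classCount-lookup : ∀ (l : List (Pt m n)) i → 1 ≤ classCount (proj₂ (List.lookup l i)) l
  classCount-lookup (p ∷ l) zero    rewrite dec-true (proj₂ p ≟ proj₂ p) refl = s≤s z≤n
  classCount-lookup (p ∷ l) (suc i) = ≤-trans (classCount-lookup l i) (m≤n+m _ _)

  classCount-lookup₂ : ∀ (l : List (Pt m n)) {i i′} → i ≢ i′ → proj₂ (List.lookup l i) ≡ proj₂ (List.lookup l i′) →
                2 ≤ classCount (proj₂ (List.lookup l i)) l
  classCount-lookup₂ (p ∷ l) {zero}  {zero}   i≢i′ _ = contradiction refl i≢i′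
  classCount-lookup₂ (p ∷ l) {zero}  {suc i′} _    eq rewrite dec-true (proj₂ p ≟ proj₂ p) refl =
    s≤s (subst (λ y → 1 ≤ classCount y l) (sym eq) (classCount-lookup l i′))
  classCount-lookup₂ (p ∷ l) {suc i} {zero}   _    eq rewrite eq | dec-true (proj₂ p ≟ proj₂ p) refl =
    s≤s (subst (λ y → 1 ≤ classCount y l) eq (classCount-lookup l i))
  classCount-lookup₂ (p ∷ l) {suc i} {suc i′} i≢i′ eq =
    ≤-trans (classCount-lookup₂ l (i≢i′ ∘ cong suc) eq) (m≤n+m _ _)

  classCount⇒lookup : ∀ (l : List (Pt m n)) y → 1 ≤ classCount y l → ∃ λ i → proj₂ (List.lookup l i) ≡ y
  classCount⇒lookup (p ∷ l) y classCount≥1 with proj₂ p ≟ y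
  ... | yes p≡y = zero , p≡y
  ... | no  _   = Data.Product.map suc id (classCount⇒lookup l y classCount≥1)

classCount-injectPt-fromℕ : ∀ {m n} (l : List (Pt m n)) → classCount (fromℕ n) (map injectPt l) ≡ 0
classCount-injectPt-fromℕ         []      = refl
classCount-injectPt-fromℕ {n = n} (p ∷ l) rewrite dec-false (inject₁ (proj₂ p) ≟ fromℕ n) (fromℕ≢inject₁ ∘ sym) =
  classCount-injectPt-fromℕ l

classCount-injectPt-inject₁ : ∀ {m n} y (l : List (Pt m n)) → classCount (inject₁ y) (map injectPt l) ≡ classCount y l
classCount-injectPt-inject₁ y []      = refl
classCount-injectPt-inject₁ y (p ∷ l) =
  cong₂ _+_ (cong boolToℕ (does-⇔ (mk⇔ inject₁-injective (cong inject₁)) (inject₁ (proj₂ p) ≟ inject₁ y) (proj₂ p ≟ y)))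
    (classCount-injectPt-inject₁ y l)

bit : ∀ {m n} → SubsetI m n → Pt m n → Bool
bit S (a , x) = lookup (lookup S a) x

SubsetI-ext : ∀ {m n} {S S′ : SubsetI m n} → (∀ p → bit S p ≡ bit S′ p) → S ≡ S′
SubsetI-ext eq = ≗⇒≡ λ a → ≗⇒≡ λ x → eq (a , x)

-- The element of ℤ_{m+1} ≀ S_n with one-line notation s.
module OneLine {m n} (s : List (Pt (suc m) n)) (length-s : length s ≡ n) (once : ∀ y → classCount y s ≡ 1) where

  v : Fin n → Pt (suc m) n
  v = List.lookup s ∘ cast (sym length-s)

  cast-injective : ∀ {j j′ : Fin n} → cast (sym length-s) j ≡ cast (sym length-s) j′ → j ≡ j′
  cast-injective {j} {j′} eq = toℕ-injective (begin
    toℕ j                       ≡⟨ toℕ-cast (sym length-s) j ⟨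
    toℕ (cast (sym length-s) j)  ≡⟨ cong toℕ eq ⟩
    toℕ (cast (sym length-s) j′) ≡⟨ toℕ-cast (sym length-s) j′ ⟩
    toℕ j′                      ∎)
    where open ≡-Reasoning

  class-injective : ∀ {j j′} → proj₂ (v j) ≡ proj₂ (v j′) → j ≡ j′
  class-injective {j} {j′} eq with cast (sym length-s) j ≟ cast (sym length-s) j′
  ... | yes same = cast-injective same
  ... | no  diff = contradiction (≤-trans (classCount-lookup₂ s diff eq) (≤-reflexive (once _))) λ { (s≤s ()) }

  class-surjective : ∀ y → ∃ λ j → proj₂ (v j) ≡ y
  class-surjective y with classCount⇒lookup s y (≤-reflexive (sym (once y)))
  ... | i , eq = cast length-s i , trans (cong (proj₂ ∘ List.lookup s) (cast-involutive (sym length-s) length-s i)) eq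

  w : Pt (suc m) n → Pt (suc m) n
  w (a , j) = rotⁱ (toℕ a) (proj₁ (v j)) , proj₂ (v j)

  w-injective : ∀ {p q} → w p ≡ w q → p ≡ q
  w-injective {a , j} {a′ , j′} eq with class-injective (cong proj₂ eq)
  ... | refl = cong (_, j) (rotⁱ-injective (toℕ c) (begin
    rotⁱ (toℕ c) a    ≡⟨ rotⁱ-toℕ-comm a c ⟨
    rotⁱ (toℕ a) c    ≡⟨ cong proj₁ eq ⟩
    rotⁱ (toℕ a′) c   ≡⟨ rotⁱ-toℕ-comm a′ c ⟩
    rotⁱ (toℕ c) a′   ∎))
    where
    open ≡-Reasoning
    c = proj₁ (v j)

  w-surjective : ∀ q → ∃ λ p → ∀ {p′} → p′ ≡ p → w p′ ≡ q
  w-surjective (b , y) with class-surjective y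
  ... | j , vj≡y = (rotⁱ (suc m ∸ toℕ (proj₁ (v j))) b , j) ,
                   λ { refl → cong₂ _,_ (rotⁱ-toℕ-inverse b (proj₁ (v j))) vj≡y }

  wreath : Wreath (suc m) n (s≤s z≤n)
  wreath = record
    { w           = w
    ; bijective   = w-injective , w-surjective
    ; equivariant = λ j i → cong (_, proj₂ (v j)) (rotⁱ-toℕ-rotⁱ i (proj₁ (v j)))
    }

  ∈Pin⇔Peak : ∀ {p} → (p ∈Pin wreath) ⇔ Peak s p
  ∈Pin⇔Peak = PeakAt-lookup⇔Peak s (sym length-s)

module Classification (m′ : ℕ) where

  -- The letter of a class x: N if P has no point ξᵃ(x), H c if ξᶜ(x) ∈ P, L if ξᵐ⁻¹(x) ∈ P.
  data Letter : Set where
    N : Letter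
    H : Fin m′ → Letter
    L : Letter

  Balanced : ∀ {n} → ℕ → Vec Letter n → Set
  Balanced b             []        = ⊤
  Balanced b             (N ∷ w)   = Balanced (suc b) w
  Balanced b             (H _ ∷ w) = Balanced b w
  Balanced (suc (suc b)) (L ∷ w)   = Balanced (suc b) w
  Balanced _             (L ∷ w)   = ⊥

  #H #L : ∀ {n} → Vec Letter n → ℕ
  #H []        = 0
  #H (H _ ∷ w) = suc (#H w)
  #H (_ ∷ w)   = #H w
  #L []        = 0
  #L (L ∷ w)   = suc (#L w)
  #L (_ ∷ w)   = #L w

  mutual
    words : (n b k j : ℕ) → List (Vec Letter n)
    words zero    b zero zero = [ [] ]
    words zero    b _    _    = []
    words (suc n) b k    j    = map (N ∷_) (words n (suc b) k j) ++ (hWords n b k j ++ lWords n b k j)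

    hWords : (n b k j : ℕ) → List (Vec Letter (suc n))
    hWords n b zero    j = []
    hWords n b (suc k) j = cartesianProductWith (λ c → H c ∷_) (allFin m′) (words n b k j)

    lWords : (n b k j : ℕ) → List (Vec Letter (suc n))
    lWords n (suc (suc b)) k (suc j) = map (L ∷_) (words n (suc b) k j)
    lWords n _             _ _       = []

  ∈-words⁺ : ∀ {n} b (w : Vec Letter n) → Balanced b w → w ∈ words n b (#H w) (#L w)
  ∈-words⁺ b [] _ = here refl
  ∈-words⁺ b (N ∷ w) bal = ∈-++⁺ˡ (∈-map⁺ (N ∷_) (∈-words⁺ (suc b) w bal))
  ∈-words⁺ {suc n} b (H c ∷ w) bal = ∈-++⁺ʳ (map (N ∷_) (words n (suc b) (suc (#H w)) (#L w))) (∈-++⁺ˡ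
    (∈-cartesianProductWith⁺ (λ c → H c ∷_) (∈-allFin c) (∈-words⁺ b w bal)))
  ∈-words⁺ {suc n} (suc (suc b)) (L ∷ w) bal =
    ∈-++⁺ʳ (map (N ∷_) (words n (suc (suc (suc b))) (#H w) (suc (#L w))))
      (∈-++⁺ʳ (hWords n (suc (suc b)) (#H w) (suc (#L w)))
    (∈-map⁺ (L ∷_) (∈-words⁺ (suc b) w bal)))

  ∈-words⁻ : ∀ n b k j {w} → w ∈ words n b k j → Balanced b w × #H w ≡ k × #L w ≡ j
  ∈-words⁻ zero b zero zero (here refl) = tt , refl , refl
  ∈-words⁻ (suc n) b k j w∈ with ∈-++⁻ (map (N ∷_) (words n (suc b) k j)) w∈
  ... | inj₁ w∈N with ∈-map⁻ (N ∷_) w∈N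
  ...   | _ , w∈′ , refl = ∈-words⁻ n (suc b) k j w∈′
  ∈-words⁻ (suc n) b k j w∈ | inj₂ w∈HL with ∈-++⁻ (hWords n b k j) w∈HL
  ∈-words⁻ (suc n) b (suc k) j _ | inj₂ _ | inj₁ w∈H
    with ∈-cartesianProductWith⁻ (λ c → H c ∷_) (allFin m′) (words n b k j) w∈H
  ... | _ , _ , _ , w∈′ , refl with ∈-words⁻ n b k j w∈′
  ...   | bal , refl , refl = bal , refl , refl
  ∈-words⁻ (suc n) (suc (suc b)) k (suc j) _ | inj₂ _ | inj₂ w∈L with ∈-map⁻ (L ∷_) w∈L
  ... | _ , w∈′ , refl with ∈-words⁻ n (suc b) k j w∈′
  ...   | bal , refl , refl = bal , refl , refl

  headLetter : ∀ {n} → Vec Letter (suc n) → Letter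
  headLetter (l ∷ _) = l

  isH : Letter → Set
  isH (H _) = ⊤
  isH _     = ⊥

  headLetter-hWords : ∀ n b k j {w} → w ∈ hWords n b k j → isH (headLetter w)
  headLetter-hWords n b (suc k) j w∈
    with ∈-cartesianProductWith⁻ (λ c → H c ∷_) (allFin m′) (words n b k j) w∈
  ... | _ , _ , _ , _ , refl = tt

  headLetter-lWords : ∀ n b k j {w} → w ∈ lWords n b k j → headLetter w ≡ L
  headLetter-lWords n (suc (suc b)) k (suc j) w∈ with ∈-map⁻ (L ∷_) w∈
  ... | _ , _ , refl = refl

  ∷-injectiveʳ : ∀ {n} {l} {v v′ : Vec Letter n} → l ∷ v ≡ l ∷ v′ → v ≡ v′
  ∷-injectiveʳ = proj₂ ∘ ∷-injective

  mutual
    words-unique : ∀ n b k j → Unique (words n b k j)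
    words-unique zero b zero zero = [] ∷ []
    words-unique zero b zero (suc j) = []
    words-unique zero b (suc k) j = []
    words-unique (suc n) b k j =
      ++⁺ (Unique-map⁺ ∷-injectiveʳ (words-unique n (suc b) k j))
          (++⁺ (hWords-unique n b k j) (lWords-unique n b k j) H∩L≡∅)
          N∩HL≡∅
      where
      H∩L≡∅ : Disjoint (hWords n b k j) (lWords n b k j)
      H∩L≡∅ (w∈H , w∈L) = subst isH (headLetter-lWords n b k j w∈L) (headLetter-hWords n b k j w∈H)
      N∩HL≡∅ : Disjoint (map (N ∷_) (words n (suc b) k j)) (hWords n b k j ++ lWords n b k j)
      N∩HL≡∅ (w∈N , w∈HL) with ∈-map⁻ (N ∷_) w∈N
      ... | _ , _ , refl with ∈-++⁻ (hWords n b k j) w∈HL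
      ...   | inj₁ w∈H = headLetter-hWords n b k j w∈H
      ...   | inj₂ w∈L with () ← headLetter-lWords n b k j w∈L

    hWords-unique : ∀ n b k j → Unique (hWords n b k j)
    hWords-unique n b zero    j = []
    hWords-unique n b (suc k) j =
      cartesianProductWith⁺ (λ c → H c ∷_) (λ { refl → refl , refl }) (allFin⁺ m′) (words-unique n b k j)

    lWords-unique : ∀ n b k j → Unique (lWords n b k j)
    lWords-unique n (suc (suc b)) k (suc j) = Unique-map⁺ ∷-injectiveʳ (words-unique n (suc b) k j)
    lWords-unique n zero          k j       = []
    lWords-unique n (suc zero)    k j       = []
    lWords-unique n (suc (suc b)) k zero    = []

  length-words-suc : ∀ n b k j → length (words (suc n) b k j) ≡
    length (words n (suc b) k j) + (length (hWords n b k j) + length (lWords n b k j))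
  length-words-suc n b k j = begin
    length (map (N ∷_) (words n (suc b) k j) ++ (hWords n b k j ++ lWords n b k j))
      ≡⟨ length-++ (map (N ∷_) (words n (suc b) k j)) ⟩
    length (map (N ∷_) (words n (suc b) k j)) + length (hWords n b k j ++ lWords n b k j)
      ≡⟨ cong₂ _+_ (length-map (N ∷_) (words n (suc b) k j)) (length-++ (hWords n b k j)) ⟩
    length (words n (suc b) k j) + (length (hWords n b k j) + length (lWords n b k j)) ∎
    where open ≡-Reasoning

  private
    split-k=0 : ∀ X Y → 1 * 1 * X + (0 + 1 * 1 * Y) ≡ 1 * 1 * (X + Y)
    split-k=0 = solve-∀
    split-k>0 : ∀ m p c₀ c₁ B X Y → m * p * c₁ * X + (m * (p * c₀ * B) + m * p * c₁ * Y) ≡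
                                    m * p * c₀ * B + m * p * (c₁ * (X + Y))
    split-k>0 = solve-∀
    pascal-factor : ∀ m p c₀ c₁ B → m * p * (c₀ + c₁) * B ≡ m * p * c₀ * B + m * p * (c₁ * B)
    pascal-factor = solve-∀

  mutual
    length-words : ∀ n b k j → length (words n b k j) ≡ m′ ^ k * (n C k) * ballots (n ∸ k) b j
    length-words zero b zero zero = refl
    length-words zero b zero (suc j) = refl
    length-words zero b (suc k) j = sym (cong (_* ballots 0 b j) (*-zeroʳ (m′ ^ suc k)))
    length-words (suc n) b zero j = begin
      length (words (suc n) b 0 j)                               ≡⟨ length-words-suc n b 0 j ⟩
      length (words n (suc b) 0 j) + (0 + length (lWords n b 0 j))
        ≡⟨ cong₂ (λ x y → x + (0 + y)) (length-words n (suc b) 0 j) (length-lWords n b 0 j) ⟩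
      1 * 1 * X + (0 + 1 * 1 * Y)                                ≡⟨ split-k=0 X Y ⟩
      1 * 1 * (X + Y)                                            ∎
      where
      open ≡-Reasoning
      X = ballots n (suc b) j
      Y = afterL (ballots n) b j
    length-words (suc n) b (suc k) j = begin
      length (words (suc n) b (suc k) j)                         ≡⟨ length-words-suc n b (suc k) j ⟩
      length (words n (suc b) (suc k) j) + (length (hWords n b (suc k) j) + length (lWords n b (suc k) j))
        ≡⟨ cong₂ _+_ (length-words n (suc b) (suc k) j)
                 (cong₂ _+_ (length-hWords n b k j) (length-lWords n b (suc k) j)) ⟩
      m′ * p * c₁ * X + (m′ * (p * c₀ * B) + m′ * p * c₁ * Y)    ≡⟨ split-k>0 m′ p c₀ c₁ B X Y ⟩
      m′ * p * c₀ * B + m′ * p * (c₁ * (X + Y))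
        ≡⟨ cong (λ z → m′ * p * c₀ * B + m′ * p * z) (C*ballots-unfold n k b j) ⟨
      m′ * p * c₀ * B + m′ * p * (c₁ * B)                        ≡⟨ pascal-factor m′ p c₀ c₁ B ⟨
      m′ * p * (c₀ + c₁) * B                                     ≡⟨ cong (λ c → m′ * p * c * B) (nCk+nC[k+1]≡[n+1]C[k+1] n k) ⟩
      m′ * p * (suc n C suc k) * B                               ∎
      where
      open ≡-Reasoning
      p = m′ ^ k
      c₀ = n C k
      c₁ = n C suc k
      B = ballots (n ∸ k) b j
      X = ballots (n ∸ suc k) (suc b) j
      Y = afterL (ballots (n ∸ suc k)) b j

    length-hWords : ∀ n b k j → length (hWords n b (suc k) j) ≡ m′ * (m′ ^ k * (n C k) * ballots (n ∸ k) b j)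
    length-hWords n b k j = begin
      length (hWords n b (suc k) j)                    ≡⟨ length-cartesianProductWith (λ c → H c ∷_) (allFin m′) _ ⟩
      length (allFin m′) * length (words n b k j)      ≡⟨ cong₂ _*_ (length-tabulate {n = m′} id) (length-words n b k j) ⟩
      m′ * (m′ ^ k * (n C k) * ballots (n ∸ k) b j)     ∎
      where open ≡-Reasoning

    length-lWords : ∀ n b k j → length (lWords n b k j) ≡ m′ ^ k * (n C k) * afterL (ballots (n ∸ k)) b j
    length-lWords n (suc (suc b)) k (suc j) = trans (length-map (L ∷_) (words n (suc b) k j)) (length-words n (suc b) k j)
    length-lWords n zero          k j       = sym (*-zeroʳ (m′ ^ k * (n C k)))
    length-lWords n (suc zero)    k j       = sym (*-zeroʳ (m′ ^ k * (n C k)))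
    length-lWords n (suc (suc b)) k zero    = sym (*-zeroʳ (m′ ^ k * (n C k)))

  -- Realising a balanced word

  last : Fin (suc m′)
  last = fromℕ m′

  minPt : ∀ {n} → Pt (suc m′) (suc n)
  minPt {n} = last , fromℕ n

  highPt : ∀ {n} → Fin m′ → Pt (suc m′) (suc n)
  highPt {n} c = inject₁ c , fromℕ n

  inject₁<fromℕ : ∀ {n} (y : Fin n) → inject₁ y Data.Fin.< fromℕ n
  inject₁<fromℕ {n} y = subst₂ _<_ (sym (toℕ-inject₁ y)) (sym (toℕ-fromℕ n)) (toℕ<n y)

  minPt-≺ : ∀ {n} (q : Pt (suc m′) n) → minPt ≺ injectPt q
  minPt-≺ (b , y) with b Data.Fin.≟ last
  ... | yes refl   = inj₂ (refl , inject₁<fromℕ y)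
  ... | no  b≢last = inj₁ (Finₚ.≤∧≢⇒< (Finₚ.≤fromℕ b) b≢last)

  last≺high : ∀ {n} (y z : Fin n) (c : Fin m′) → (last , y) ≺ (inject₁ c , z)
  last≺high y z c = inj₁ (subst₂ _<_ (sym (toℕ-inject₁ c)) (sym (toℕ-fromℕ m′)) (toℕ<n c))

  -- For a word w, the troughs are the points ξ^{m-1}(x) for the classes x with letter N,
  -- listed in ≺-increasing order; the pinnacles are the points encoded by the letters L and H.
  troughs lowPeaks highPeaks : ∀ {n} → Vec Letter n → List (Pt (suc m′) n)
  troughs []        = []
  troughs (N ∷ w)   = minPt ∷ map injectPt (troughs w)
  troughs (_ ∷ w)   = map injectPt (troughs w)
  lowPeaks []       = []
  lowPeaks (L ∷ w)  = minPt ∷ map injectPt (lowPeaks w)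
  lowPeaks (_ ∷ w)  = map injectPt (lowPeaks w)
  highPeaks []        = []
  highPeaks (H c ∷ w) = highPt c ∷ map injectPt (highPeaks w)
  highPeaks (_ ∷ w)   = map injectPt (highPeaks w)

  peaks : ∀ {n} → Vec Letter n → List (Pt (suc m′) n)
  peaks w = lowPeaks w ++ highPeaks w

  ∈-map-injectPt : ∀ {n} (P : Fin (suc m′) → Set) (l : List (Pt (suc m′) n)) →
    (∀ {p} → p ∈ l → P (proj₁ p)) → ∀ {p} → p ∈ map injectPt l → P (proj₁ p)
  ∈-map-injectPt P l all∈ p∈ with ∈-map⁻ injectPt p∈
  ... | _ , p∈l , refl = all∈ p∈l

  troughs-last : ∀ {n} (w : Vec Letter n) {p} → p ∈ troughs w → proj₁ p ≡ last
  troughs-last (N ∷ w)   (here refl) = refl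
  troughs-last (N ∷ w)   (there p∈)  = ∈-map-injectPt (_≡ last) (troughs w) (troughs-last w) p∈
  troughs-last (H _ ∷ w) p∈          = ∈-map-injectPt (_≡ last) (troughs w) (troughs-last w) p∈
  troughs-last (L ∷ w)   p∈          = ∈-map-injectPt (_≡ last) (troughs w) (troughs-last w) p∈

  highPeaks-high : ∀ {n} (w : Vec Letter n) {p} → p ∈ highPeaks w → ∃ λ c → proj₁ p ≡ inject₁ c
  highPeaks-high (H c ∷ w) (here refl) = c , refl
  highPeaks-high (H _ ∷ w) (there p∈)  = ∈-map-injectPt _ (highPeaks w) (highPeaks-high w) p∈
  highPeaks-high (N ∷ w)   p∈          = ∈-map-injectPt _ (highPeaks w) (highPeaks-high w) p∈
  highPeaks-high (L ∷ w)   p∈          = ∈-map-injectPt _ (highPeaks w) (highPeaks-high w) p∈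

  trough≺highPeak : ∀ {n} (w : Vec Letter n) {u h} → u ∈ troughs w → h ∈ highPeaks w → u ≺ h
  trough≺highPeak w {_ , y} {_ , z} u∈ h∈ with troughs-last w u∈ | highPeaks-high w h∈
  ... | refl | c , refl = last≺high y z c

  troughs-ascending : ∀ {n} (w : Vec Letter n) → Linked _≺_ (troughs w)
  troughs-ascending []        = []
  troughs-ascending (N ∷ w)   = minPt-∷ (troughs w) (Linked-injectPt (troughs-ascending w))
    where
    minPt-∷ : ∀ l → Linked _≺_ (map injectPt l) → Linked _≺_ (minPt ∷ map injectPt l)
    minPt-∷ []      _   = [-]
    minPt-∷ (q ∷ l) asc = minPt-≺ q ∷ asc
  troughs-ascending (H _ ∷ w) = Linked-injectPt (troughs-ascending w)
  troughs-ascending (L ∷ w)   = Linked-injectPt (troughs-ascending w)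

  -- The ballot condition at height b, in terms of the construction: Interlaced 0 w says that
  -- the (i+1)-st trough lies below the i-th low pinnacle.
  Interlaced : ∀ {n} → ℕ → Vec Letter n → Set
  Interlaced zero    w = Below (drop 1 (troughs w)) (lowPeaks w)
  Interlaced (suc c) w = Below (troughs w) (drop c (lowPeaks w))

  balanced⇒interlaced : ∀ {n} b (w : Vec Letter n) → Balanced b w → Interlaced b w
  balanced⇒interlaced zero          []        _   = tt
  balanced⇒interlaced (suc zero)    []        _   = tt
  balanced⇒interlaced (suc (suc c)) []        _   = tt
  balanced⇒interlaced zero          (N ∷ w)   bal =
    Below-injectPt-drop 0 0 (troughs w) (lowPeaks w) (balanced⇒interlaced 1 w bal)
  balanced⇒interlaced (suc c)       (N ∷ w)   bal =
    Below-∷ c minPt (map injectPt (troughs w)) (map injectPt (lowPeaks w))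
      (Below-injectPt-drop 0 (suc c) (troughs w) (lowPeaks w) (balanced⇒interlaced (suc (suc c)) w bal))
      (λ p∈ → let _ , _ , p≡ = ∈-map⁻ injectPt p∈ in subst (minPt ≺_) (sym p≡) (minPt-≺ _))
  balanced⇒interlaced zero          (H _ ∷ w) bal =
    Below-injectPt-drop 1 0 (troughs w) (lowPeaks w) (balanced⇒interlaced zero w bal)
  balanced⇒interlaced (suc c)       (H _ ∷ w) bal =
    Below-injectPt-drop 0 c (troughs w) (lowPeaks w) (balanced⇒interlaced (suc c) w bal)
  balanced⇒interlaced (suc (suc c)) (L ∷ w)   bal =
    Below-injectPt-drop 0 c (troughs w) (lowPeaks w) (balanced⇒interlaced (suc c) w bal)

  length-lowPeaks : ∀ {n} (w : Vec Letter n) → length (lowPeaks w) ≡ #L w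
  length-lowPeaks []        = refl
  length-lowPeaks (N ∷ w)   = trans (length-map injectPt (lowPeaks w)) (length-lowPeaks w)
  length-lowPeaks (H _ ∷ w) = trans (length-map injectPt (lowPeaks w)) (length-lowPeaks w)
  length-lowPeaks (L ∷ w)   = cong suc (trans (length-map injectPt (lowPeaks w)) (length-lowPeaks w))

  length-highPeaks : ∀ {n} (w : Vec Letter n) → length (highPeaks w) ≡ #H w
  length-highPeaks []        = refl
  length-highPeaks (N ∷ w)   = trans (length-map injectPt (highPeaks w)) (length-highPeaks w)
  length-highPeaks (H _ ∷ w) = cong suc (trans (length-map injectPt (highPeaks w)) (length-highPeaks w))
  length-highPeaks (L ∷ w)   = trans (length-map injectPt (highPeaks w)) (length-highPeaks w)

  length-troughs : ∀ {n} (w : Vec Letter n) → length (troughs w) + (#L w + #H w) ≡ n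
  length-troughs []        = refl
  length-troughs (N ∷ w)   = cong suc (trans (cong (_+ (#L w + #H w)) (length-map injectPt (troughs w))) (length-troughs w))
  length-troughs (H _ ∷ w) = begin
    length (map injectPt (troughs w)) + (#L w + suc (#H w))
      ≡⟨ cong (_+ (#L w + suc (#H w))) (length-map injectPt (troughs w)) ⟩
    length (troughs w) + (#L w + suc (#H w))                 ≡⟨ cong (length (troughs w) +_) (+-suc (#L w) (#H w)) ⟩
    length (troughs w) + suc (#L w + #H w)                   ≡⟨ +-suc (length (troughs w)) _ ⟩
    suc (length (troughs w) + (#L w + #H w))                 ≡⟨ cong suc (length-troughs w) ⟩
    suc _                                                    ∎
    where open ≡-Reasoning
  length-troughs (L ∷ w)   = begin
    length (map injectPt (troughs w)) + suc (#L w + #H w)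
      ≡⟨ cong (_+ suc (#L w + #H w)) (length-map injectPt (troughs w)) ⟩
    length (troughs w) + suc (#L w + #H w)                   ≡⟨ +-suc (length (troughs w)) _ ⟩
    suc (length (troughs w) + (#L w + #H w))                 ≡⟨ cong suc (length-troughs w) ⟩
    suc _                                                    ∎
    where open ≡-Reasoning

  sequence : ∀ {n} → Vec Letter n → List (Pt (suc m′) n)
  sequence w = interleave (troughs w) (peaks w)

  length-sequence : ∀ {n} (w : Vec Letter n) → length (sequence w) ≡ n
  length-sequence w = begin
    length (interleave (troughs w) (peaks w))                 ≡⟨ length-interleave (troughs w) (peaks w) ⟩
    length (troughs w) + length (lowPeaks w ++ highPeaks w)   ≡⟨ cong (length (troughs w) +_) (length-++ (lowPeaks w)) ⟩
    length (troughs w) + (length (lowPeaks w) + length (highPeaks w))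
      ≡⟨ cong (λ k → length (troughs w) + k) (cong₂ _+_ (length-lowPeaks w) (length-highPeaks w)) ⟩
    length (troughs w) + (#L w + #H w)                        ≡⟨ length-troughs w ⟩
    _                                                         ∎
    where open ≡-Reasoning

  Peak-sequence⇔ : ∀ {n} (w : Vec Letter n) → Balanced 0 w → 2 * (#L w + #H w) < n →
                   ∀ {q} → Peak (sequence w) q ⇔ q ∈ peaks w
  Peak-sequence⇔ {n} w bal 2k<n = Peak-interleave⇔ (troughs w) (peaks w) (troughs-ascending w)
    (Below-++ (drop 1 (troughs w)) (lowPeaks w) (highPeaks w) (balanced⇒interlaced 0 w bal) enough-troughs
      (λ u∈ h∈ → trough≺highPeak w (∈-drop1 (troughs w) u∈) h∈))
    where
    K = #L w + #H w
    ∈-drop1 : ∀ {A : Set} (l : List A) {u} → u ∈ drop 1 l → u ∈ l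
    ∈-drop1 (_ ∷ _) = there
    ≤-length-drop1 : ∀ {A : Set} (l : List A) {k} → suc k ≤ length l → k ≤ length (drop 1 l)
    ≤-length-drop1 (_ ∷ _) (s≤s k≤) = k≤
    more-troughs-than-peaks : suc K ≤ length (troughs w)
    more-troughs-than-peaks = +-cancelʳ-≤ K (suc K) (length (troughs w)) (begin
      suc K + K            ≡⟨ cong (λ k → suc (K + k)) (+-identityʳ K) ⟨
      suc (2 * K)          ≤⟨ 2k<n ⟩
      n                    ≡⟨ length-troughs w ⟨
      length (troughs w) + K ∎)
      where open ≤-Reasoning
    enough-troughs : length (lowPeaks w) + length (highPeaks w) ≤ length (drop 1 (troughs w))
    enough-troughs = subst (_≤ length (drop 1 (troughs w))) (sym (cong₂ _+_ (length-lowPeaks w) (length-highPeaks w)))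
      (≤-length-drop1 (troughs w) more-troughs-than-peaks)

  classCount-peaks : ∀ {n} (w : Vec Letter n) y → classCount y (troughs w) + (classCount y (lowPeaks w) + classCount y (highPeaks w)) ≡ 1
  classCount-peaks {suc n} (l ∷ w) y with view y
  ... | ‵fromℕ     = new-class l
    where
    new-class : ∀ l → classCount (fromℕ n) (troughs (l ∷ w)) + (classCount (fromℕ n) (lowPeaks (l ∷ w)) + classCount (fromℕ n) (highPeaks (l ∷ w))) ≡ 1
    new-class N rewrite classCount-injectPt-fromℕ (troughs w) | classCount-injectPt-fromℕ (lowPeaks w)
                      | classCount-injectPt-fromℕ (highPeaks w) | dec-true (fromℕ n ≟ fromℕ n) refl = refl
    new-class (H _) rewrite classCount-injectPt-fromℕ (troughs w) | classCount-injectPt-fromℕ (lowPeaks w)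
                      | classCount-injectPt-fromℕ (highPeaks w) | dec-true (fromℕ n ≟ fromℕ n) refl = refl
    new-class L rewrite classCount-injectPt-fromℕ (troughs w) | classCount-injectPt-fromℕ (lowPeaks w)
                      | classCount-injectPt-fromℕ (highPeaks w) | dec-true (fromℕ n ≟ fromℕ n) refl = refl
  ... | ‵inject₁ y′ = trans (old-class l) (classCount-peaks w y′)
    where
    old-class : ∀ l → classCount (inject₁ y′) (troughs (l ∷ w)) + (classCount (inject₁ y′) (lowPeaks (l ∷ w)) + classCount (inject₁ y′) (highPeaks (l ∷ w))) ≡
                      classCount y′ (troughs w) + (classCount y′ (lowPeaks w) + classCount y′ (highPeaks w))
    old-class N rewrite classCount-injectPt-inject₁ y′ (troughs w) | classCount-injectPt-inject₁ y′ (lowPeaks w)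
                      | classCount-injectPt-inject₁ y′ (highPeaks w) | dec-false (fromℕ n ≟ inject₁ y′) fromℕ≢inject₁ = refl
    old-class (H _) rewrite classCount-injectPt-inject₁ y′ (troughs w) | classCount-injectPt-inject₁ y′ (lowPeaks w)
                      | classCount-injectPt-inject₁ y′ (highPeaks w) | dec-false (fromℕ n ≟ inject₁ y′) fromℕ≢inject₁ = refl
    old-class L rewrite classCount-injectPt-inject₁ y′ (troughs w) | classCount-injectPt-inject₁ y′ (lowPeaks w)
                      | classCount-injectPt-inject₁ y′ (highPeaks w) | dec-false (fromℕ n ≟ inject₁ y′) fromℕ≢inject₁ = refl

  classCount-sequence : ∀ {n} (w : Vec Letter n) y → classCount y (sequence w) ≡ 1
  classCount-sequence w y = begin
    classCount y (interleave (troughs w) (lowPeaks w ++ highPeaks w))           ≡⟨ classCount-interleave y (troughs w) (peaks w) ⟩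
    classCount y (troughs w) + classCount y (lowPeaks w ++ highPeaks w)                ≡⟨ cong (classCount y (troughs w) +_) (classCount-++ y (lowPeaks w) (highPeaks w)) ⟩
    classCount y (troughs w) + (classCount y (lowPeaks w) + classCount y (highPeaks w))       ≡⟨ classCount-peaks w y ⟩
    1                                                                    ∎
    where open ≡-Reasoning

  -- Encoding words as subsets

  column : Letter → Fin (suc m′) → Bool
  column N     _ = false
  column (H c) a = does (inject₁ c ≟ a)
  column L     a = does (last ≟ a)

  -- The head of a word describes the top class n, so classes are appended on the right.
  encode : ∀ {n} → Vec Letter n → SubsetI (suc m′) n
  encode []      = replicate (suc m′) []
  encode (l ∷ w) = zipWith _∷ʳ_ (encode w) (tabulate (column l))

  bit-encode-fromℕ : ∀ {n} l (w : Vec Letter n) a → bit (encode (l ∷ w)) (a , fromℕ n) ≡ column l a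
  bit-encode-fromℕ l w a rewrite lookup-zipWith _∷ʳ_ a (encode w) (tabulate (column l)) =
    trans (lookup-∷ʳ-fromℕ (lookup (encode w) a) _) (lookup∘tabulate (column l) a)

  bit-encode-inject₁ : ∀ {n} l (w : Vec Letter n) a y → bit (encode (l ∷ w)) (a , inject₁ y) ≡ bit (encode w) (a , y)
  bit-encode-inject₁ l w a y rewrite lookup-zipWith _∷ʳ_ a (encode w) (tabulate (column l)) =
    lookup-∷ʳ-inject₁ (lookup (encode w) a) _ y

  bit-encode : ∀ {n} (w : Vec Letter n) a i → bit (encode w) (a , opposite i) ≡ column (lookup w i) a
  bit-encode (l ∷ w) a zero    = bit-encode-fromℕ l w a
  bit-encode (l ∷ w) a (suc i) = trans (bit-encode-inject₁ l w a (opposite i)) (bit-encode w a i)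

  newPeaks : ∀ {n} → Letter → List (Pt (suc m′) (suc n))
  newPeaks N     = []
  newPeaks (H c) = [ highPt c ]
  newPeaks L     = [ minPt ]

  peaks-∷ : ∀ {n} l (w : Vec Letter n) → peaks (l ∷ w) ↭ newPeaks l ++ map injectPt (peaks w)
  peaks-∷ N     w = ↭-reflexive (sym (map-++ injectPt (lowPeaks w) (highPeaks w)))
  peaks-∷ (H c) w = ↭-trans (shift (highPt c) (map injectPt (lowPeaks w)) (map injectPt (highPeaks w)))
                            (prep (highPt c) (↭-reflexive (sym (map-++ injectPt (lowPeaks w) (highPeaks w)))))
  peaks-∷ L     w = prep minPt (↭-reflexive (sym (map-++ injectPt (lowPeaks w) (highPeaks w))))

  ∈-peaks-∷ : ∀ {n} l (w : Vec Letter n) {p} → p ∈ peaks (l ∷ w) ⇔ p ∈ newPeaks l ++ map injectPt (peaks w)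
  ∈-peaks-∷ l w = mk⇔ (∈-resp-↭ (peaks-∷ l w)) (∈-resp-↭ (↭-sym (peaks-∷ l w)))

  fromℕ∉map-injectPt : ∀ {n} a (ps : List (Pt (suc m′) n)) → (a , fromℕ n) ∉ map injectPt ps
  fromℕ∉map-injectPt a ps p∈ with ∈-map⁻ injectPt p∈
  ... | _ , _ , eq = fromℕ≢inject₁ (cong proj₂ eq)

  ∈-map-injectPt⇔ : ∀ {n} a y (ps : List (Pt (suc m′) n)) → (a , inject₁ y) ∈ map injectPt ps ⇔ (a , y) ∈ ps
  ∈-map-injectPt⇔ a y ps = mk⇔ to (∈-map⁺ injectPt)
    where
    to : (a , inject₁ y) ∈ map injectPt ps → (a , y) ∈ ps
    to p∈ with ∈-map⁻ injectPt p∈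
    ... | _ , q∈ , eq = subst (_∈ ps) (sym (cong₂ _,_ (cong proj₁ eq) (inject₁-injective (cong proj₂ eq)))) q∈

  newPeaks-fromℕ : ∀ {n} l {p} → p ∈ newPeaks {n} l → proj₂ p ≡ fromℕ n
  newPeaks-fromℕ (H c) (here refl) = refl
  newPeaks-fromℕ L     (here refl) = refl

  ∈-newPeaks⇔column : ∀ {n} l a → (a , fromℕ n) ∈ newPeaks l ⇔ column l a ≡ true
  ∈-newPeaks⇔column N     a = mk⇔ (λ ()) (λ ())
  ∈-newPeaks⇔column (H c) a = mk⇔ (λ { (here refl) → dec-true (inject₁ c ≟ inject₁ c) refl })
                                   (λ eq → here (cong (_, fromℕ _) (sym (does⇒ (inject₁ c ≟ a) eq))))
  ∈-newPeaks⇔column L     a = mk⇔ (λ { (here refl) → dec-true (last ≟ last) refl })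
                                   (λ eq → here (cong (_, fromℕ _) (sym (does⇒ (last ≟ a) eq))))

  ∈-peaks⇔ : ∀ {n} (w : Vec Letter n) a i → (a , opposite i) ∈ peaks w ⇔ column (lookup w i) a ≡ true
  ∈-peaks⇔ {suc n} (l ∷ w) a zero = begin
    (a , fromℕ n) ∈ peaks (l ∷ w)                          ≈⟨ ∈-peaks-∷ l w ⟩
    (a , fromℕ n) ∈ newPeaks l ++ map injectPt (peaks w)   ≈⟨ ∈-++-onlyˡ (newPeaks l) (fromℕ∉map-injectPt a (peaks w)) ⟩
    (a , fromℕ n) ∈ newPeaks l                             ≈⟨ ∈-newPeaks⇔column l a ⟩
    column l a ≡ true                                      ∎
    where open ⇔-Reasoning
  ∈-peaks⇔ {suc n} (l ∷ w) a (suc i) = begin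
    (a , inject₁ (opposite i)) ∈ peaks (l ∷ w)                          ≈⟨ ∈-peaks-∷ l w ⟩
    (a , inject₁ (opposite i)) ∈ newPeaks l ++ map injectPt (peaks w)
      ≈⟨ ∈-++-onlyʳ (newPeaks l) (λ p∈ → fromℕ≢inject₁ (sym (newPeaks-fromℕ l p∈))) ⟩
    (a , inject₁ (opposite i)) ∈ map injectPt (peaks w)                 ≈⟨ ∈-map-injectPt⇔ a (opposite i) (peaks w) ⟩
    (a , opposite i) ∈ peaks w                                          ≈⟨ ∈-peaks⇔ w a i ⟩
    column (lookup w i) a ≡ true                                        ∎
    where open ⇔-Reasoning

  ∈S-encode⇔ : ∀ {n} (w : Vec Letter n) p → (p ∈S encode w) ⇔ p ∈ peaks w
  ∈S-encode⇔ w (a , x) = ∀-opposite (λ x → ((a , x) ∈S encode w) ⇔ (a , x) ∈ peaks w) at x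
    where
    at : ∀ i → ((a , opposite i) ∈S encode w) ⇔ (a , opposite i) ∈ peaks w
    at i = begin
      bit (encode w) (a , opposite i) ≡ true   ≈⟨ mk⇔ (trans (sym (bit-encode w a i))) (trans (bit-encode w a i)) ⟩
      column (lookup w i) a ≡ true            ≈⟨ ∈-peaks⇔ w a i ⟨
      (a , opposite i) ∈ peaks w              ∎
      where open ⇔-Reasoning

  balanced⇒admissible : ∀ {n} (w : Vec Letter n) → Balanced 0 w → 2 * (#L w + #H w) < n →
                        Admissible (suc m′) n (s≤s z≤n) (encode w)
  balanced⇒admissible w bal small = wreath , λ p → begin
    p ∈S encode w        ≈⟨ ∈S-encode⇔ w p ⟩
    p ∈ peaks w          ≈⟨ Peak-sequence⇔ w bal small ⟨
    Peak (sequence w) p  ≈⟨ ∈Pin⇔Peak ⟨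
    p ∈Pin wreath        ∎
    where
    open ⇔-Reasoning
    open OneLine (sequence w) (length-sequence w) (classCount-sequence w) using (wreath; ∈Pin⇔Peak)

  letterOf : (Fin (suc m′) → Bool) → Letter
  letterOf g with g last | any? (λ c → g (inject₁ c) Bool.≟ true)
  ... | true  | _           = L
  ... | false | yes (c , _) = H c
  ... | false | no  _       = N

  decode : ∀ {n} → SubsetI (suc m′) n → Vec Letter n
  decode P = tabulate (λ i → letterOf (λ a → bit P (a , opposite i)))

  column-last : ∀ l → column l last ≡ true → l ≡ L
  column-last (H c) eq = contradiction (does⇒ (inject₁ c ≟ last) eq) (fromℕ≢inject₁ ∘ sym)
  column-last L     _  = refl

  column-inject₁ : ∀ l {c} → column l (inject₁ c) ≡ true → l ≡ H c
  column-inject₁ (H c′) eq = cong H (inject₁-injective (does⇒ (inject₁ c′ ≟ inject₁ _) eq))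
  column-inject₁ L      eq = contradiction (does⇒ (last ≟ inject₁ _) eq) fromℕ≢inject₁

  column-none : ∀ l → column l last ≡ false → (∀ c → column l (inject₁ c) ≢ true) → l ≡ N
  column-none N     _      _    = refl
  column-none (H c) _      none = contradiction (dec-true (inject₁ c ≟ inject₁ c) refl) (none c)
  column-none L     L-last _    = contradiction (trans (sym (dec-true (last ≟ last) refl)) L-last) λ ()

  letterOf-column : ∀ g l → (∀ a → g a ≡ column l a) → letterOf g ≡ l
  letterOf-column g l g≗l with g last in g-last | any? (λ c → g (inject₁ c) Bool.≟ true)
  ... | true  | _            = sym (column-last l (trans (sym (g≗l last)) g-last))
  ... | false | yes (c , gc) = sym (column-inject₁ l (trans (sym (g≗l (inject₁ c))) gc))
  ... | false | no  none     = sym (column-none l (trans (sym (g≗l last)) g-last)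
                                               λ c lc → none (c , trans (g≗l (inject₁ c)) lc))

  decode-encode : ∀ {n} (w : Vec Letter n) → decode (encode w) ≡ w
  decode-encode w = trans (tabulate-cong λ i → letterOf-column _ (lookup w i) (λ a → bit-encode w a i)) (tabulate∘lookup w)

  encode-injective : ∀ {n} {w w′ : Vec Letter n} → encode w ≡ encode w′ → w ≡ w′
  encode-injective {w = w} {w′} eq = begin
    w                      ≡⟨ decode-encode w ⟨
    decode (encode w)      ≡⟨ cong decode eq ⟩
    decode (encode w′)     ≡⟨ decode-encode w′ ⟩
    w′                     ∎
    where open ≡-Reasoning

  letterOf≡L : ∀ g → letterOf g ≡ L → g last ≡ true
  letterOf≡L g _ with g last | any? (λ c → g (inject₁ c) Bool.≟ true)
  letterOf≡L g _  | true  | _     = refl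
  letterOf≡L g () | false | yes _
  letterOf≡L g () | false | no  _

  letterOf≡N : ∀ g → (∀ a → g a ≡ false) → letterOf g ≡ N
  letterOf≡N g none = letterOf-column g N none

  column-letterOf : ∀ g → (∀ {a a′} → g a ≡ true → g a′ ≡ true → a ≡ a′) → ∀ a → column (letterOf g) a ≡ g a
  column-letterOf g unique a with g last in g-last | any? (λ c → g (inject₁ c) Bool.≟ true)
  ... | true  | _            = does-≟-unique g unique g-last a
  ... | false | yes (c , gc) = does-≟-unique g unique gc a
  ... | false | no  none     with view a
  ...   | ‵fromℕ     = sym g-last
  ...   | ‵inject₁ c = sym (¬-not λ gc → none (c , gc))

  ColumnUnique : ∀ {n} → SubsetI (suc m′) n → Set
  ColumnUnique P = ∀ {a a′ x} → bit P (a , x) ≡ true → bit P (a′ , x) ≡ true → a ≡ a′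

  encode-decode : ∀ {n} (P : SubsetI (suc m′) n) → ColumnUnique P → encode (decode P) ≡ P
  encode-decode P unique =
    SubsetI-ext λ (a , x) → ∀-opposite (λ x → bit (encode (decode P)) (a , x) ≡ bit P (a , x)) (at a) x
    where
    at : ∀ a i → bit (encode (decode P)) (a , opposite i) ≡ bit P (a , opposite i)
    at a i = begin
      bit (encode (decode P)) (a , opposite i)            ≡⟨ bit-encode (decode P) a i ⟩
      column (lookup (decode P) i) a                      ≡⟨ cong (λ l → column l a) (lookup∘tabulate _ i) ⟩
      column (letterOf (λ b → bit P (b , opposite i))) a  ≡⟨ column-letterOf _ unique a ⟩
      bit P (a , opposite i)                              ∎
      where open ≡-Reasoning

  countTrue-column : ∀ l → countTrue (tabulate (column l)) ≡ #H (l ∷ []) + #L (l ∷ [])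
  countTrue-column N     = countTrue-false (suc m′)
  countTrue-column (H c) = countTrue-does-≟ (inject₁ c)
  countTrue-column L     = countTrue-does-≟ last

  ∣encode∣ : ∀ {n} (w : Vec Letter n) → ∣ encode w ∣ ≡ #H w + #L w
  ∣encode∣ []      = ∣replicate[]∣ (suc m′)
  ∣encode∣ (l ∷ w) = begin
    ∣ zipWith _∷ʳ_ (encode w) (tabulate (column l)) ∣         ≡⟨ ∣zipWith-∷ʳ∣ (encode w) (tabulate (column l)) ⟩
    countTrue (tabulate (column l)) + ∣ encode w ∣            ≡⟨ cong₂ _+_ (countTrue-column l) (∣encode∣ w) ⟩
    (#H (l ∷ []) + #L (l ∷ [])) + (#H w + #L w)               ≡⟨ letter-count l ⟩
    #H (l ∷ w) + #L (l ∷ w)                                   ∎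
    where
    open ≡-Reasoning
    letter-count : ∀ l → (#H (l ∷ []) + #L (l ∷ [])) + (#H w + #L w) ≡ #H (l ∷ w) + #L (l ∷ w)
    letter-count N     = refl
    letter-count (H _) = refl
    letter-count L     = sym (+-suc (#H w) (#L w))

  -- The word of an admissible set is balanced

  isL? : ∀ l → Dec (l ≡ L)
  isL? N     = no λ ()
  isL? (H _) = no λ ()
  isL? L     = yes refl

  isN? : ∀ l → Dec (l ≡ N)
  isN? N     = yes refl
  isN? (H _) = no λ ()
  isN? L     = no λ ()

  countBefore : ∀ {n} {Q : Letter → Set} → (∀ l → Dec (Q l)) → ℕ → Vec Letter n → ℕ
  countBefore Q? t w = count (λ j → (toℕ j ℕ.<? t) ×-dec Q? (lookup w j))

  countBefore-∷ : ∀ {n} {Q : Letter → Set} (Q? : ∀ l → Dec (Q l)) t l (w : Vec Letter n) →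
                  countBefore Q? (suc t) (l ∷ w) ≡ boolToℕ (does (Q? l)) + countBefore Q? t w
  countBefore-∷ Q? t l w = cong (boolToℕ (does (Q? l)) +_)
    (count-cong (λ j → (toℕ (suc j) ℕ.<? suc t) ×-dec Q? (lookup (l ∷ w) (suc j)))
                (λ j → (toℕ j ℕ.<? t) ×-dec Q? (lookup w j)) λ _ → refl)

  countBefore-0 : ∀ {n} {Q : Letter → Set} (Q? : ∀ l → Dec (Q l)) (w : Vec Letter n) → countBefore Q? 0 w ≡ 0
  countBefore-0 Q? w = count-none (λ j → (toℕ j ℕ.<? 0) ×-dec Q? (lookup w j)) λ _ ()

  -- Position i of a word describes the class opposite i, so the positions before i are the classes above it.
  CountBalanced : ∀ {n} → ℕ → Vec Letter n → Set
  CountBalanced b w =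
    ∀ i → lookup w i ≡ L → suc (countBefore isL? (suc (toℕ i)) w) ≤ b + countBefore isN? (toℕ i) w

  L-needs-2 : ∀ {n} b (w : Vec Letter n) → CountBalanced b (L ∷ w) → 2 ≤ b
  L-needs-2 b w h = begin
    2                                            ≤⟨ s≤s (s≤s z≤n) ⟩
    suc (1 + countBefore isL? 0 w)               ≡⟨ cong suc (countBefore-∷ isL? 0 L w) ⟨
    suc (countBefore isL? 1 (L ∷ w))             ≤⟨ h zero refl ⟩
    b + countBefore isN? 0 (L ∷ w)               ≡⟨ cong (b +_) (countBefore-0 isN? (L ∷ w)) ⟩
    b + 0                                        ≡⟨ +-identityʳ b ⟩
    b                                            ∎
    where open ≤-Reasoning

  countBalanced⇒balanced : ∀ {n} b (w : Vec Letter n) → CountBalanced b w → Balanced b w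
  countBalanced⇒balanced b []        _ = tt
  countBalanced⇒balanced b (N ∷ w)   h = countBalanced⇒balanced (suc b) w λ i Lᵢ → subst₂ _≤_
    (cong suc (countBefore-∷ isL? (suc (toℕ i)) N w))
    (trans (cong (b +_) (countBefore-∷ isN? (toℕ i) N w)) (+-suc b _))
    (h (suc i) Lᵢ)
  countBalanced⇒balanced b (H c ∷ w) h = countBalanced⇒balanced b w λ i Lᵢ → subst₂ _≤_
    (cong suc (countBefore-∷ isL? (suc (toℕ i)) (H c) w))
    (cong (b +_) (countBefore-∷ isN? (toℕ i) (H c) w))
    (h (suc i) Lᵢ)
  countBalanced⇒balanced (suc (suc b)) (L ∷ w) h = countBalanced⇒balanced (suc b) w λ i Lᵢ → ≤-pred (subst₂ _≤_
    (cong suc (countBefore-∷ isL? (suc (toℕ i)) L w))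
    (cong (suc (suc b) +_) (countBefore-∷ isN? (toℕ i) L w))
    (h (suc i) Lᵢ))
  countBalanced⇒balanced 0             (L ∷ w) h = contradiction (L-needs-2 0 w h) λ ()
  countBalanced⇒balanced 1             (L ∷ w) h = contradiction (L-needs-2 1 w h) λ { (s≤s ()) }

  below-last : ∀ {n} {a : Fin (suc m′)} {y y′ : Fin n} → (a , y) ≺ (last , y′) → a ≡ last × toℕ y′ < toℕ y
  below-last {a = a} (inj₁ last<a) = contradiction (≤fromℕ a) (<⇒≱ last<a)
  below-last (inj₂ (a≡last , y′<y)) = a≡last , y′<y

  lookup-decode : ∀ {n} (P : SubsetI (suc m′) n) i → lookup (decode P) i ≡ letterOf (λ a → bit P (a , opposite i))
  lookup-decode P i = lookup∘tabulate _ i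

  module _ {n} (W : Wreath (suc m′) n (s≤s z≤n)) (P : SubsetI (suc m′) n)
           (P⇔Pin : ∀ p → (p ∈S P) ⇔ (p ∈Pin W)) where

    open Wreath W using (bijective; equivariant) renaming (w to σ)

    v : Fin n → Pt (suc m′) n
    v j = σ (emb (s≤s z≤n) j)

    class-injective : ∀ {j j′} → proj₂ (v j) ≡ proj₂ (v j′) → j ≡ j′
    class-injective {j} {j′} eq =
      cong proj₂ (proj₁ bijective (trans (equivariant j k) (cong₂ _,_ (rotⁱ-reach a a′) eq)))
      where
      a  = proj₁ (v j)
      a′ = proj₁ (v j′)
      k  = toℕ a′ + (suc m′ ∸ toℕ a)

    locate : ∀ {p} → p ∈S P → ∃ λ j → v j ≡ p
    locate {p} p∈P with Equivalence.to (P⇔Pin p) p∈P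
    ... | _ , j , _ , _ , _ , vj≡p , _ = j , vj≡p

    pinnacle : ∀ {j} → v j ∈S P →
               ∃₂ λ i k → toℕ j ≡ suc (toℕ i) × toℕ k ≡ suc (toℕ j) × v k ≺ v j × v i ≺ v j
    pinnacle {j} vj∈P with Equivalence.to (P⇔Pin (v j)) vj∈P
    ... | i , j′ , k , j′≡1+i , k≡1+j′ , vj′≡vj , k≺j , i≺j with class-injective (cong proj₂ vj′≡vj)
    ...   | refl = i , k , j′≡1+i , k≡1+j′ , k≺j , i≺j

    no-adjacent-pinnacles : ∀ {i j} → v i ∈S P → v j ∈S P → toℕ j ≡ suc (toℕ i) → ⊥
    no-adjacent-pinnacles {i} {j} vi∈P vj∈P j≡1+i with pinnacle vi∈P | pinnacle vj∈P
    ... | _ , k , _ , k≡1+i , k≺i , _ | i′ , _ , j≡1+i′ , _ , _ , i′≺j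
      with toℕ-injective (trans k≡1+i (sym j≡1+i)) | toℕ-injective (suc-injective (trans (sym j≡1+i′) j≡1+i))
    ...   | refl | refl = ≺-asym k≺i i′≺j

    column-unique : ColumnUnique P
    column-unique {a} {a′} {x} ax∈P a′x∈P with locate ax∈P | locate a′x∈P
    ... | j , vj≡ax | j′ , vj′≡a′x with class-injective (trans (cong proj₂ vj≡ax) (sym (cong proj₂ vj′≡a′x)))
    ...   | refl = cong proj₁ (trans (sym vj≡ax) vj′≡a′x)

    class-empty : ∀ {k} → ¬ (v k ∈S P) → ∀ a → bit P (a , proj₂ (v k)) ≡ false
    class-empty {k} vk∉P a with bit P (a , proj₂ (v k)) in a∈?
    ... | false = refl
    ... | true with locate a∈?
    ...   | j , vj≡ with class-injective (cong proj₂ vj≡)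
    ...     | refl = contradiction (subst (_∈S P) (sym vj≡) a∈?) vk∉P

    ∈P-last : ∀ i → lookup (decode P) i ≡ L → (last , opposite i) ∈S P
    ∈P-last i Lᵢ = letterOf≡L _ (trans (sym (lookup-decode P i)) Lᵢ)

    module _ (i₀ : Fin n) (L-at-i₀ : lookup (decode P) i₀ ≡ L) where

      InP InU : Fin n → Set
      InP k = v k ∈S P × proj₁ (v k) ≡ last × toℕ (opposite (proj₂ (v k))) < suc (toℕ i₀)
      InU k = ¬ (v k ∈S P) × proj₁ (v k) ≡ last × toℕ (opposite (proj₂ (v k))) < toℕ i₀

      InP? : ∀ k → Dec (InP k)
      InP? k = (bit P (v k) Bool.≟ true) ×-dec (proj₁ (v k) ≟ last)
               ×-dec (toℕ (opposite (proj₂ (v k))) ℕ.<? suc (toℕ i₀))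

      InU? : ∀ k → Dec (InU k)
      InU? k = ¬? (bit P (v k) Bool.≟ true) ×-dec (proj₁ (v k) ≟ last)
               ×-dec (toℕ (opposite (proj₂ (v k))) ℕ.<? toℕ i₀)

      locate-low : ∀ j → lookup (decode P) j ≡ L → ∃ λ k → v k ≡ (last , opposite j)
      locate-low j Lⱼ = locate (∈P-last j Lⱼ)

      InP-at : ∀ {k j} → v k ≡ (last , opposite j) → lookup (decode P) j ≡ L → toℕ j < suc (toℕ i₀) → InP k
      InP-at {k} {j} vk≡ Lⱼ j≤i₀ rewrite vk≡ | opposite-involutive j = ∈P-last j Lⱼ , refl , j≤i₀

      lows-to-pinnacles : countBefore isL? (suc (toℕ i₀)) (decode P) ≤ count InP?
      lows-to-pinnacles = count-injection (λ j → (toℕ j ℕ.<? suc (toℕ i₀)) ×-dec isL? (lookup (decode P) j)) InP?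
        (λ (_ , Lⱼ) → proj₁ (locate-low _ Lⱼ)) (λ (j≤i₀ , Lⱼ) → InP-at (proj₂ (locate-low _ Lⱼ)) Lⱼ j≤i₀) injective
        where
        injective : ∀ {j j′} (p : _ × lookup (decode P) j ≡ L) (q : _ × lookup (decode P) j′ ≡ L) →
                    proj₁ (locate-low j (proj₂ p)) ≡ proj₁ (locate-low j′ (proj₂ q)) → j ≡ j′
        injective {j} {j′} (_ , Lⱼ) (_ , Lⱼ′) eq = opposite-injective (cong proj₂ (begin
          (last , opposite j)              ≡⟨ proj₂ (locate-low j Lⱼ) ⟨
          v (proj₁ (locate-low j Lⱼ))      ≡⟨ cong v eq ⟩
          v (proj₁ (locate-low j′ Lⱼ′))    ≡⟨ proj₂ (locate-low j′ Lⱼ′) ⟩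
          (last , opposite j′)             ∎))
          where open ≡-Reasoning

      neighbour-InU : ∀ {k i} → InP k → v i ≺ v k → ¬ (v i ∈S P) → InU i
      neighbour-InU {k} {i} (_ , k-last , k≤i₀) i≺k vi∉P
        with below-last (subst (λ a → v i ≺ (a , proj₂ (v k))) k-last i≺k)
      ... | i-last , k<i = vi∉P , i-last , <-≤-trans (opposite-< k<i) (≤-pred k≤i₀)

      pinnacles-to-troughs : suc (count InP?) ≤ count InU?
      pinnacles-to-troughs = count-neighbours InP? InU? left right (k₀ , InP-at vk₀≡ L-at-i₀ ≤-refl)
        where
        left : ∀ {k} → InP k → ∃ λ i → toℕ k ≡ suc (toℕ i) × InU i
        left k∈ with pinnacle (proj₁ k∈)
        ... | i , _ , k≡1+i , _ , _ , i≺k =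
          i , k≡1+i , neighbour-InU k∈ i≺k λ vi∈P → no-adjacent-pinnacles vi∈P (proj₁ k∈) k≡1+i
        right : ∀ {k} → InP k → ∃ λ i → toℕ i ≡ suc (toℕ k) × InU i
        right k∈ with pinnacle (proj₁ k∈)
        ... | _ , i , _ , i≡1+k , i≺k , _ =
          i , i≡1+k , neighbour-InU k∈ i≺k λ vi∈P → no-adjacent-pinnacles (proj₁ k∈) vi∈P i≡1+k
        k₀ = proj₁ (locate-low i₀ L-at-i₀)
        vk₀≡ = proj₂ (locate-low i₀ L-at-i₀)

      troughs-to-Ns : count InU? ≤ countBefore isN? (toℕ i₀) (decode P)
      troughs-to-Ns = count-injection InU? (λ j → (toℕ j ℕ.<? toℕ i₀) ×-dec isN? (lookup (decode P) j))
        (λ {k} _ → opposite (proj₂ (v k))) into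
        (λ _ _ eq → class-injective (opposite-injective eq))
        where
        into : ∀ {k} → InU k →
               toℕ (opposite (proj₂ (v k))) < toℕ i₀ × lookup (decode P) (opposite (proj₂ (v k))) ≡ N
        into {k} (vk∉P , _ , k<i₀) = k<i₀ , trans (lookup-decode P _) (letterOf≡N _ λ a →
          subst (λ c → bit P (a , c) ≡ false) (sym (opposite-involutive (proj₂ (v k)))) (class-empty vk∉P a))

    admissible⇒countBalanced : CountBalanced 0 (decode P)
    admissible⇒countBalanced i₀ L-at-i₀ = ≤-trans (s≤s (lows-to-pinnacles i₀ L-at-i₀))
                                    (≤-trans (pinnacles-to-troughs i₀ L-at-i₀) (troughs-to-Ns i₀ L-at-i₀))

  admissible⇒balanced-decode : ∀ {n} (P : SubsetI (suc m′) n) → Admissible (suc m′) n (s≤s z≤n) P →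
                               encode (decode P) ≡ P × Balanced 0 (decode P)
  admissible⇒balanced-decode P (W , P⇔Pin) =
    encode-decode P (column-unique W P P⇔Pin) , countBalanced⇒balanced 0 (decode P) (admissible⇒countBalanced W P P⇔Pin)

  -- Enumeration

  wordsWithH : ∀ n d k → List (Vec Letter n)
  wordsWithH n d k = concatMap (words n 0 k) (upTo (suc (d ∸ k)))

  wordsUpTo : ∀ n d → List (Vec Letter n)
  wordsUpTo n d = concatMap (wordsWithH n d) (upTo (suc d))

  ∈-wordsUpTo⁺ : ∀ {n d} (w : Vec Letter n) → Balanced 0 w → #H w + #L w ≤ d → w ∈ wordsUpTo n d
  ∈-wordsUpTo⁺ {n} {d} w bal k+j≤d =
    ∈-concatMap⁺ (wordsWithH n d) (lose (∈-upTo⁺ (s≤s (≤-trans (m≤m+n _ _) k+j≤d)))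
      (∈-concatMap⁺ (words n 0 (#H w)) (lose (∈-upTo⁺ (s≤s j≤d∸k)) (∈-words⁺ 0 w bal))))
    where
    j≤d∸k : #L w ≤ d ∸ #H w
    j≤d∸k = ≤-trans (≤-reflexive (sym (m+n∸m≡n (#H w) (#L w)))) (∸-monoˡ-≤ (#H w) k+j≤d)

  ∈-wordsWithH⁻ : ∀ {n d k} {w : Vec Letter n} → w ∈ wordsWithH n d k →
                  Balanced 0 w × #H w ≡ k × #L w ≤ d ∸ k
  ∈-wordsWithH⁻ {n} {d} {k} w∈ with find (∈-concatMap⁻ (words n 0 k) {upTo (suc (d ∸ k))} w∈)
  ... | j , j∈ , w∈kj with ∈-words⁻ n 0 k j w∈kj
  ...   | bal , #H≡k , refl = bal , #H≡k , ≤-pred (∈-upTo⁻ j∈)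

  ∈-wordsUpTo⁻ : ∀ {n d} {w : Vec Letter n} → w ∈ wordsUpTo n d → Balanced 0 w × #H w + #L w ≤ d
  ∈-wordsUpTo⁻ {n} {d} {w} w∈ with find (∈-concatMap⁻ (wordsWithH n d) {upTo (suc d)} w∈)
  ... | k , k∈ , w∈k with ∈-wordsWithH⁻ {n} {d} {k} w∈k
  ...   | bal , refl , j≤d∸k = bal , (begin
    #H w + #L w           ≤⟨ +-monoʳ-≤ (#H w) j≤d∸k ⟩
    #H w + (d ∸ #H w)     ≡⟨ m+[n∸m]≡n (≤-pred (∈-upTo⁻ k∈)) ⟩
    d                     ∎)
    where open ≤-Reasoning

  wordsUpTo-unique : ∀ n d → Unique (wordsUpTo n d)
  wordsUpTo-unique n d = Unique-concatMap (wordsWithH n d) (upTo⁺ (suc d)) same-k different-k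
    where
    #L-of : ∀ {k j w} → w ∈ words n 0 k j → #L w ≡ j
    #L-of {k} {j} w∈ = proj₂ (proj₂ (∈-words⁻ n 0 k j w∈))
    same-k : ∀ k → Unique (wordsWithH n d k)
    same-k k = Unique-concatMap (words n 0 k) (upTo⁺ (suc (d ∸ k))) (words-unique n 0 k)
      λ j≢j′ (w∈ , w∈′) → j≢j′ (trans (sym (#L-of w∈)) (#L-of w∈′))
    different-k : ∀ {k k′} → k ≢ k′ → Disjoint (wordsWithH n d k) (wordsWithH n d k′)
    different-k {k} {k′} k≢k′ (w∈ , w∈′) =
      k≢k′ (trans (sym (proj₁ (proj₂ (∈-wordsWithH⁻ {n} {d} {k} w∈))))
                  (proj₁ (proj₂ (∈-wordsWithH⁻ {n} {d} {k′} w∈′))))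

  length-wordsWithH : ∀ n d k → k ≤ d → 2 * d < n →
    length (wordsWithH n d k) ≡ m′ ^ k * (n C k) * ((n ∸ k ∸ 1) C (d ∸ k))
  length-wordsWithH n d k k≤d 2d<n = begin
    length (concatMap (words n 0 k) js)               ≡⟨ length-concatMap (words n 0 k) js ⟩
    sum (map (length ∘ words n 0 k) js)
      ≡⟨ cong sum (map-cong-local {xs = js} (All.tabulate λ {j} _ → length-words n 0 k j)) ⟩
    sum (map (λ j → c * ballots (n ∸ k) 0 j) js)      ≡⟨ sum-map-* c (ballots (n ∸ k) 0) js ⟩
    c * sum (map (ballots (n ∸ k) 0) js)              ≡⟨ cong (c *_) ballot-sum ⟩
    c * ((n ∸ k ∸ 1) C (d ∸ k))                       ∎
    where
    open ≡-Reasoning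
    c  = m′ ^ k * (n C k)
    js = upTo (suc (d ∸ k))
    n∸k≡1+n∸k∸1 : n ∸ k ≡ suc (n ∸ k ∸ 1)
    n∸k≡1+n∸k∸1 = ∸≡suc[∸∸1] (≤-<-trans k≤d (≤-<-trans (m≤n*m d 2) 2d<n))
    ballot-sum : sum (map (ballots (n ∸ k) 0) js) ≡ (n ∸ k ∸ 1) C (d ∸ k)
    ballot-sum rewrite n∸k≡1+n∸k∸1 =
      sum-ballots (n ∸ k ∸ 1) (d ∸ k) (subst (2 * (d ∸ k) ≤_) n∸k≡1+n∸k∸1 (2[d∸k]≤n∸k k≤d 2d<n))

  length-wordsUpTo : ∀ n d → 2 * d < n → length (wordsUpTo n d) ≡ formula (suc m′) n d
  length-wordsUpTo n d 2d<n = trans (length-concatMap (wordsWithH n d) (upTo (suc d)))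
    (cong sum (map-cong-local {xs = upTo (suc d)}
      (All.tabulate λ k∈ → length-wordsWithH n d _ (≤-pred (∈-upTo⁻ k∈)) 2d<n)))

  ∈-encodings⇔InAPS : ∀ {n d} P → 2 * d < n → P ∈ map encode (wordsUpTo n d) ⇔ InAPS (suc m′) n (s≤s z≤n) d P
  ∈-encodings⇔InAPS {n} {d} P 2d<n = mk⇔ sound complete
    where
    sound : P ∈ map encode (wordsUpTo n d) → InAPS (suc m′) n (s≤s z≤n) d P
    sound P∈ with ∈-map⁻ encode P∈
    ... | w , w∈ , refl with ∈-wordsUpTo⁻ w∈
    ...   | bal , k+j≤d =
      balanced⇒admissible w bal (≤-<-trans (*-monoʳ-≤ 2 j+k≤d) 2d<n) , subst (_≤ d) (sym (∣encode∣ w)) k+j≤d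
      where
      j+k≤d : #L w + #H w ≤ d
      j+k≤d = subst (_≤ d) (+-comm (#H w) (#L w)) k+j≤d
    complete : InAPS (suc m′) n (s≤s z≤n) d P → P ∈ map encode (wordsUpTo n d)
    complete (admissible , ∣P∣≤d) = subst (_∈ map encode (wordsUpTo n d)) encode-decode-P
      (∈-map⁺ encode (∈-wordsUpTo⁺ (decode P) bal (subst (_≤ d) ∣P∣≡ ∣P∣≤d)))
      where
      encode-decode-P : encode (decode P) ≡ P
      encode-decode-P = proj₁ (admissible⇒balanced-decode P admissible)
      bal : Balanced 0 (decode P)
      bal = proj₂ (admissible⇒balanced-decode P admissible)
      ∣P∣≡ : ∣ P ∣ ≡ #H (decode P) + #L (decode P)
      ∣P∣≡ = trans (cong ∣_∣ (sym encode-decode-P)) (∣encode∣ (decode P))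

mainTheorem3 : (m n : ℕ) (0<m : 0 < m) → 0 < n → (d : ℕ) → d ≤ (n ∸ 1) / 2 →
    HasCardAPS m n 0<m d (formula m n d)
mainTheorem3 (suc m′) n (s≤s z≤n) 0<n d d≤ =
  map encode (wordsUpTo n d) ,
  Unique-map⁺ encode-injective (wordsUpTo-unique n d) ,
  (λ P → ∈-encodings⇔InAPS P 2d<n) ,
  trans (length-map encode (wordsUpTo n d)) (length-wordsUpTo n d 2d<n)
  where
  open Classification m′
  2d<n : 2 * d < n
  2d<n = d≤[n∸1]/2⇒2d<n d≤ 0<n
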